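{- Let $n\geq 3$, let $G=\langle x,y:~x^n=y^2=e,~yxy=x^{ -1}\rangle$ be the dihedral group of order $2n$, and let $A=\langle x\rangle$. (1) If $D\subseteq A$ is a difference set in $A$ with parameters $\left(n,\frac{2n-1-\sqrt{8n-7}}{2},n+1-\sqrt{8n-7}\right)$, then $\Gamma(D)=\mathrm{Cay}(G,A^\#\cup yD)$ is a strictly Deza dihedrant of WL-rank $4$. (2) For every integer $m\geq 2$ which is not divisible by $4$, the graph $K_4\times K_m$ is a strictly Deza dihedrant of WL-rank $4$.
   Context: All graphs are finite, undirected, without loops and multiple edges. For a finite group $G$ with identity $e$, $G^\#=G\setminus\{e\}$. For $S\subseteq G$ with $e\notin S$ and $S=S^{ -1}$, the Cayley graph $\mathrm{Cay}(G,S)$ has vertex set $G$ and edges $\{g,sg\}$ for $g\in G$, $s\in S$. A dihedrant is a graph isomorphic to a Cayley graph over a dihedral group (of order $2n$, $n\geq 3$). A subset $D$ of a group $H$ is a difference set with parameters $(v,k,\lambda)$ if $|H|=v$, $|D|=k$, $\lambda$ is a positive integer, and every element of $H^\#$ can be written as $d_1^{ -1}d_2$ with $d_1,d_2\in D$ in exactly $\lambda$ ways. A $k$-regular graph on $n$ vertices is a Deza graph with parameters $(n,k,b,a)$ if every pair of distinct vertices has either $a$ or $b$ common neighbours. A graph is strongly regular if it is $k$-regular and there are $\lambda,\mu$ such that adjacent vertices have $\lambda$ common neighbours and distinct nonadjacent vertices have $\mu$ common neighbours. A strictly Deza graph is a Deza graph which is not strongly regular and has diameter $2$. The WL-closure of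 a graph $\Gamma=(V,E)$ is the smallest coherent configuration on $V$ such that $E$ is a union of its classes; the WL-rank of $\Gamma$ is the number of classes of this coherent configuration. For a Cayley graph $\mathrm{Cay}(G,S)$ this coincides with the rank (number of basic sets) of the smallest S-ring over $G$ in which $S$ is a union of basic sets. $K_n$ is the complete graph on $n$ vertices and $\Gamma_1\times\Gamma_2$ is the Cartesian product: vertex set $V_1\times V_2$, with $(v_1,v_2)\sim(u_1,u_2)$ iff ($v_1=u_1$ and $v_2\sim u_2$) or ($v_2=u_2$ and $v_1\sim u_1$). -}

module Defs where

open import Data.Nat using (ℕ; zero; suc; _+_; _*_; _∸_; _≤_; NonZero)
open import Data.Nat.DivMod using (_mod_)
open import Data.Fin using (Fin; toℕ; _≟_)
open import Data.Fin.Properties using (*↔×)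
open import Data.Bool using (Bool; true; false; _∧_; _∨_; not; if_then_else_)
open import Data.Product using (Σ; ∃; ∃-syntax; _×_; _,_)
open import Relation.Binary.PropositionalEquality using (_≡_)
open import Relation.Nullary using (¬_)
open import Relation.Nullary.Decidable using (⌊_⌋)
open import Function.Bundles using (_↔_; Inverse)

countFin : ∀ {N} → (Fin N → Bool) → ℕ
countFin {zero}  P = 0
countFin {suc N} P = (if P Fin.zero then 1 else 0) + countFin (λ i → P (Fin.suc i))
  where import Data.Fin as Fin

eqFin : ∀ {r} → Fin r → Fin r → Bool
eqFin i j = ⌊ i ≟ j ⌋

record Graph : Set₁ where
  field
    V     : Set
    order : ℕ
    enum  : Fin order ↔ V
    adj   : V → V → Bool

module _ (Γ : Graph) where
  open Graph Γ

  countV : (V → Bool) → ℕ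
  countV P = countFin (λ i → P (Inverse.to enum i))

  degree : V → ℕ
  degree v = countV (λ w → adj v w)

  commonNbrs : V → V → ℕ
  commonNbrs u v = countV (λ w → adj u w ∧ adj w v)

  IsRegular : ℕ → Set
  IsRegular k = ∀ v → degree v ≡ k

  IsDezaWith : ℕ → ℕ → ℕ → Set
  IsDezaWith k b a = IsRegular k ×
    (∀ u v → ¬ u ≡ v → (commonNbrs u v ≡ a) Data.Sum.⊎ (commonNbrs u v ≡ b))
    where import Data.Sum

  IsDeza : Set
  IsDeza = ∃[ k ] ∃[ b ] ∃[ a ] IsDezaWith k b a

  IsStronglyRegular : Set
  IsStronglyRegular = ∃[ k ] ∃[ λ′ ] ∃[ μ ]
    (IsRegular k ×
     (∀ u v → adj u v ≡ true → commonNbrs u v ≡ λ′) ×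
     (∀ u v → ¬ u ≡ v → adj u v ≡ false → commonNbrs u v ≡ μ))

  HasDiameter2 : Set
  HasDiameter2 =
    (∀ u v → ¬ u ≡ v → adj u v ≡ false → ∃[ w ] (adj u w ≡ true × adj w v ≡ true)) ×
    (∃[ u ] ∃[ v ] (¬ u ≡ v × adj u v ≡ false))

  IsStrictlyDeza : Set
  IsStrictlyDeza = IsDeza × ¬ IsStronglyRegular × HasDiameter2

  -- Coherent configurations on V, given as a colouring
  -- c : V → V → Fin r of V × V whose colour classes are the classes.
  record IsCoherentConfig {r : ℕ} (c : V → V → Fin r) : Set where
    field
      -- every colour is used (exactly r classes)
      surj     : ∀ i → ∃[ u ] ∃[ v ] c u v ≡ i
      -- the diagonal is a union of classes
      diag     : ∀ u v w → c u u ≡ c v w → v ≡ w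
      transp   : ∀ u v u′ v′ → c u v ≡ c u′ v′ → c v u ≡ c v′ u′
      interNum : ∀ u v u′ v′ → c u v ≡ c u′ v′ → ∀ i j →
        countV (λ w → eqFin (c u w) i ∧ eqFin (c w v) j)
          ≡ countV (λ w → eqFin (c u′ w) i ∧ eqFin (c w v′) j)

  EdgesUnionOfClasses : ∀ {r} → (V → V → Fin r) → Set
  EdgesUnionOfClasses c = ∀ u v u′ v′ → c u v ≡ c u′ v′ → adj u v ≡ adj u′ v′

  -- c is the WL-closure: the smallest (coarsest) coherent configuration
  -- such that the edge set is a union of its classes
  IsWLClosure : ∀ {r} → (V → V → Fin r) → Set
  IsWLClosure {r} c = IsCoherentConfig c × EdgesUnionOfClasses c ×
    (∀ {r′} (c′ : V → V → Fin r′) → IsCoherentConfig c′ → EdgesUnionOfClasses c′ →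
       ∀ u v u′ v′ → c′ u v ≡ c′ u′ v′ → c u v ≡ c u′ v′)

  HasWLRank : ℕ → Set
  HasWLRank r = Σ (V → V → Fin r) IsWLClosure

_≅_ : Graph → Graph → Set
Γ ≅ Δ = Σ (Graph.V Γ ↔ Graph.V Δ) λ f →
  ∀ u v → Graph.adj Γ u v ≡ Graph.adj Δ (Inverse.to f u) (Inverse.to f v)

module _ {n : ℕ} {{_ : NonZero n}} where
  _+ₙ_ : Fin n → Fin n → Fin n
  i +ₙ j = (toℕ i + toℕ j) mod n

  -ₙ_ : Fin n → Fin n
  -ₙ i = (n ∸ toℕ i) mod n

  0ₙ : Fin n
  0ₙ = 0 mod n

-- Dihedral group of order 2n: the pair (b , i) stands for y^b x^i,
-- with x^n = y^2 = e and y x y = x⁻¹, so that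
-- (y^a x^i)(y^b x^j) = y^(a+b) x^((-1)^b i + j).
Dih : ℕ → Set
Dih n = Fin 2 × Fin n

module _ {n : ℕ} {{_ : NonZero n}} where
  eD : Dih n
  eD = (Fin.zero , 0ₙ)
    where import Data.Fin as Fin

  _·_ : Dih n → Dih n → Dih n
  (a , i) · (b , j) = ((toℕ a + toℕ b) mod 2 ,
                       ((if ⌊ b ≟ Fin.zero ⌋ then i else (-ₙ i)) +ₙ j))
    where import Data.Fin as Fin

  _⁻¹ : Dih n → Dih n
  (a , i) ⁻¹ = if ⌊ a ≟ Fin.zero ⌋ then (a , -ₙ i) else (a , i)
    where import Data.Fin as Fin

  xD yD : Dih n
  xD = (Fin.zero , 1 mod n) where import Data.Fin as Fin
  yD = (Fin.suc Fin.zero , 0ₙ) where import Data.Fin as Fin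

  eqDih : Dih n → Dih n → Bool
  eqDih (a , i) (b , j) = eqFin a b ∧ eqFin i j

  Cay : (Dih n → Bool) → Graph
  Cay S = record
    { V = Dih n ; order = 2 * n ; enum = *↔× ; adj = λ g h → S (h · (g ⁻¹)) }

  IsConnectionSet : (Dih n → Bool) → Set
  IsConnectionSet S = (S eD ≡ false) × (∀ g → S (g ⁻¹) ≡ S g)

IsDihedrant : Graph → Set
IsDihedrant Γ = ∃[ m ] Σ (NonZero m) λ nz → 3 ≤ m ×
  Σ (Dih m → Bool) λ S → IsConnectionSet {{nz}} S × (Γ ≅ Cay {{nz}} S)

-- Difference sets in A = ⟨x⟩ ≅ Z_n (x^i ↦ i); D ⊆ A given as Fin n → Bool.
-- d₁⁻¹ d₂ corresponds to d₂ - d₁.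

sumFin : ∀ {N} → (Fin N → ℕ) → ℕ
sumFin {zero}  f = 0
sumFin {suc N} f = f Fin.zero + sumFin (λ i → f (Fin.suc i))
  where import Data.Fin as Fin

module _ {n : ℕ} {{_ : NonZero n}} where
  reps : (Fin n → Bool) → Fin n → ℕ
  reps D h = sumFin (λ d₁ → countFin (λ d₂ →
      D d₁ ∧ D d₂ ∧ eqFin (d₂ +ₙ (-ₙ d₁)) h))

  IsDifferenceSet : (Fin n → Bool) → ℕ → ℕ → ℕ → Set
  IsDifferenceSet D v k λ′ = (v ≡ n) × (countFin D ≡ k) × (1 ≤ λ′) ×
    (∀ h → ¬ h ≡ 0ₙ → reps D h ≡ λ′)

  -- Γ(D) = Cay(G, A^# ∪ yD), where yD = { y x^d : d ∈ D }
  ΓD : (Fin n → Bool) → Graph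
  ΓD D = Cay S
    where
      S : Dih n → Bool
      S (a , i) = if eqFin a Fin.zero then not (eqFin i 0ₙ) else D i
        where import Data.Fin as Fin

KK : ℕ → ℕ → Graph
KK a b = record
  { V = Fin a × Fin b ; order = a * b ; enum = *↔×
  ; adj = λ { (u₁ , u₂) (v₁ , v₂) →
      (eqFin u₁ v₁ ∧ not (eqFin u₂ v₂)) ∨ (eqFin u₂ v₂ ∧ not (eqFin u₁ v₁)) } }

IsStrictlyDezaDihedrantWLRank4 : Graph → Set
IsStrictlyDezaDihedrantWLRank4 Γ =
  IsDihedrant Γ × IsStrictlyDeza Γ × HasWLRank Γ 4

{-# OPTIONS --safe #-}
-- Both graphs carry a four-class colouring of ordered vertex pairs: the diagonal, two edge
-- classes and the non-edges.  If the colouring is coherent, pairs in the two edge classes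
-- have different numbers of common neighbours, and every non-adjacent pair has as many as
-- one of them (and at least one), then the graph is a strictly Deza graph; and since any
-- coherent configuration containing the edges already separates diagonal, adjacency and
-- number of common neighbours, the colouring is the WL-closure, of rank 4.
-- For Γ(D) the colouring is u, v ↦ class (v u⁻¹) for the partition {e}, A^#, yD, y(A ∖ D)
-- of the dihedral group; its structure constants only depend on |D| = k and on the
-- difference-set count λ, and the common-neighbour numbers are 2k on A^# and y(A ∖ D) and
-- 2k − 2 on yD, because (n − 2) + λ = 2k.
-- For K_4 × K_m the colour records which coordinates agree (m − 2, 2 and 2 common
-- neighbours, so m ≠ 4 is needed), and when 4 ∤ m the Chinese remainder theorem turns the
-- rotation exponent's residues into an isomorphism of K_4 × K_m with a Cayley graph over
-- the dihedral group of order 4m.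
module Submission where

open import Defs
open import Data.Nat
  using (ℕ; zero; suc; _+_; _*_; _∸_; _≤_; _<_; z≤n; s≤s; NonZero; _%_; >-nonZero⁻¹)
open import Data.Nat.DivMod
  using (_mod_; m%n<n; m<n⇒m%n≡m; %-distribˡ-+; m%n%n≡m%n; n%n≡0; m∣n⇒o%n%m≡o%m)
open import Data.Nat.Divisibility
  using (_∣_; _∣?_; divides; m%n≡0⇒n∣m; ∣⇒≤; 0∣⇒≡0; ∣-refl; ∣-trans; *-monoˡ-∣)
open import Data.Nat.Coprimality using (Coprime; coprime-divisor)
open import Data.Nat.Properties hiding (_≟_)
open import Data.Nat.Solver using (module +-*-Solver)
open import Data.Fin using (Fin; zero; suc; toℕ; _≟_; punchIn; punchOut; _↑ˡ_; _↑ʳ_; quotRem; combine)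
open import Data.Fin.Properties using (*↔×)
import Data.Fin.Properties as Finₚ
open import Data.Bool using (Bool; true; false; _∧_; _∨_; not; if_then_else_)
open import Data.Bool.Properties using (∧-comm; ∧-assoc; ∧-idem; ∧-identityʳ; not-injective)
open import Data.Product using (∃-syntax; _×_; _,_; proj₁; proj₂; map₂; swap; uncurry)
open import Data.Empty using (⊥-elim)
open import Data.Sum using (_⊎_; inj₁; inj₂; [_,_]′)
open import Function using (_∘_; _⇔_; mk⇔; Equivalence; Inverse; _↔_; Injection; mk↔ₛ′)
open import Function.Construct.Identity using (↔-id)
open import Function.Properties.Inverse using (↔-sym; ↔⇒↣)
open import Function.Definitions using (Injective)
open import Relation.Binary.PropositionalEquality
open import Relation.Nullary using (¬_; yes; no)
open import Relation.Nullary.Decidable using (dec-true; dec-false; does-⇔; isYes≗does)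
open import Level using (0ℓ)
open import Algebra.Core using (Op₁; Op₂)
open import Algebra.Bundles using (Group; AbelianGroup)
open import Algebra.Structures using (IsGroup)
open import Algebra.Definitions
  using (Associative; Commutative; Identity; LeftIdentity; RightIdentity; LeftInverse; RightInverse)
import Algebra.Properties.Group as GroupProperties
import Algebra.Properties.AbelianGroup as AbelianGroupProperties
import Algebra.Definitions as AlgDef
open import Algebra.Properties.CommutativeSemigroup +-commutativeSemigroup using (x∙yz≈y∙xz)
open +-*-Solver using (solve; _:=_; _:+_; _:*_; con)

χ : Bool → ℕ
χ true  = 1
χ false = 0

χ-∧ : ∀ a b → χ (a ∧ b) ≡ χ a * χ b
χ-∧ true  b = sym (+-identityʳ (χ b))
χ-∧ false b = refl

eqFin-refl : ∀ {N} (i : Fin N) → eqFin i i ≡ true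
eqFin-refl i = trans (isYes≗does (i ≟ i)) (dec-true (i ≟ i) refl)

eqFin-≢ : ∀ {N} {i j : Fin N} → i ≢ j → eqFin i j ≡ false
eqFin-≢ {i = i} {j} i≢j = trans (isYes≗does (i ≟ j)) (dec-false (i ≟ j) i≢j)

eqFin-true : ∀ {N} {i j : Fin N} → eqFin i j ≡ true → i ≡ j
eqFin-true {i = i} {j} e with i ≟ j
... | yes i≡j = i≡j

eqFin-⇔ : ∀ {N M} {i j : Fin N} {k l : Fin M} → (i ≡ j ⇔ k ≡ l) → eqFin i j ≡ eqFin k l
eqFin-⇔ {i = i} {j} {k} {l} e =
  trans (isYes≗does (i ≟ j)) (trans (does-⇔ e (i ≟ j) (k ≟ l)) (sym (isYes≗does (k ≟ l))))

eqFin-sym : ∀ {N} (i j : Fin N) → eqFin i j ≡ eqFin j i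
eqFin-sym i j = eqFin-⇔ (mk⇔ sym sym)

sumFin-cong : ∀ {N} {f g : Fin N → ℕ} → (∀ i → f i ≡ g i) → sumFin f ≡ sumFin g
sumFin-cong {zero}  e = refl
sumFin-cong {suc N} e = cong₂ _+_ (e zero) (sumFin-cong (e ∘ suc))

countFin≡sumFin : ∀ {N} (P : Fin N → Bool) → countFin P ≡ sumFin (χ ∘ P)
countFin≡sumFin {zero}  P = refl
countFin≡sumFin {suc N} P with P zero
... | true  = cong suc (countFin≡sumFin (P ∘ suc))
... | false = countFin≡sumFin (P ∘ suc)

countFin-cong : ∀ {N} {P Q : Fin N → Bool} → (∀ i → P i ≡ Q i) → countFin P ≡ countFin Q
countFin-cong {P = P} {Q} e = begin
  countFin P         ≡⟨ countFin≡sumFin P ⟩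
  sumFin (χ ∘ P)     ≡⟨ sumFin-cong (cong χ ∘ e) ⟩
  sumFin (χ ∘ Q)     ≡⟨ countFin≡sumFin Q ⟨
  countFin Q         ∎
  where open ≡-Reasoning

sumFin-+ : ∀ {N} (f g : Fin N → ℕ) → sumFin (λ i → f i + g i) ≡ sumFin f + sumFin g
sumFin-+ {zero}  f g = refl
sumFin-+ {suc N} f g = begin
  f zero + g zero + sumFin (λ i → f (suc i) + g (suc i))
    ≡⟨ cong (f zero + g zero +_) (sumFin-+ (f ∘ suc) (g ∘ suc)) ⟩
  f zero + g zero + (sumFin (f ∘ suc) + sumFin (g ∘ suc))
    ≡⟨ +-assoc (f zero) _ _ ⟩
  f zero + (g zero + (sumFin (f ∘ suc) + sumFin (g ∘ suc)))
    ≡⟨ cong (f zero +_) (x∙yz≈y∙xz (g zero) (sumFin (f ∘ suc)) (sumFin (g ∘ suc))) ⟩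
  f zero + (sumFin (f ∘ suc) + (g zero + sumFin (g ∘ suc)))
    ≡⟨ +-assoc (f zero) _ _ ⟨
  sumFin f + sumFin g ∎
  where open ≡-Reasoning

sumFin-*ˡ : ∀ {N} c (f : Fin N → ℕ) → sumFin (λ i → c * f i) ≡ c * sumFin f
sumFin-*ˡ {zero}  c f = sym (*-zeroʳ c)
sumFin-*ˡ {suc N} c f =
  trans (cong (c * f zero +_) (sumFin-*ˡ c (f ∘ suc))) (sym (*-distribˡ-+ c (f zero) _))

sumFin-const : ∀ {N} x → sumFin {N} (λ _ → x) ≡ N * x
sumFin-const {zero}  x = refl
sumFin-const {suc N} x = cong (x +_) (sumFin-const {N} x)

sumFin-swap : ∀ {M N} (f : Fin M → Fin N → ℕ) →
  sumFin (λ i → sumFin (f i)) ≡ sumFin (λ j → sumFin (λ i → f i j))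
sumFin-swap {zero}  {N} f = trans (sym (*-zeroʳ N)) (sym (sumFin-const {N} 0))
sumFin-swap {suc M} {N} f = begin
  sumFin (f zero) + sumFin (λ i → sumFin (f (suc i)))
    ≡⟨ cong (sumFin (f zero) +_) (sumFin-swap (f ∘ suc)) ⟩
  sumFin (f zero) + sumFin (λ j → sumFin (λ i → f (suc i) j))
    ≡⟨ sumFin-+ (f zero) _ ⟨
  sumFin (λ j → sumFin (λ i → f i j)) ∎
  where open ≡-Reasoning

sumFin-punchIn : ∀ {N} (f : Fin (suc N) → ℕ) p → sumFin f ≡ f p + sumFin (f ∘ punchIn p)
sumFin-punchIn f zero = refl
sumFin-punchIn {suc N} f (suc p) = begin
  f zero + sumFin (f ∘ suc)
    ≡⟨ cong (f zero +_) (sumFin-punchIn (f ∘ suc) p) ⟩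
  f zero + (f (suc p) + sumFin (f ∘ suc ∘ punchIn p))
    ≡⟨ x∙yz≈y∙xz (f zero) (f (suc p)) _ ⟩
  f (suc p) + (f zero + sumFin (f ∘ suc ∘ punchIn p)) ∎
  where open ≡-Reasoning

sumFin-∘-injective : ∀ {N} (f : Fin N → ℕ) {σ : Fin N → Fin N} →
  Injective _≡_ _≡_ σ → sumFin (f ∘ σ) ≡ sumFin f
sumFin-∘-injective {zero}  f σ-inj = refl
sumFin-∘-injective {suc N} f {σ} σ-inj = begin
  f p + sumFin (f ∘ σ ∘ suc)
    ≡⟨ cong (f p +_) (sumFin-cong (λ i → cong f (sym (Finₚ.punchIn-punchOut (p≢ i))))) ⟩
  f p + sumFin (f ∘ punchIn p ∘ τ)
    ≡⟨ cong (f p +_) (sumFin-∘-injective (f ∘ punchIn p) τ-injective) ⟩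
  f p + sumFin (f ∘ punchIn p)
    ≡⟨ sumFin-punchIn f p ⟨
  sumFin f ∎
  where
    open ≡-Reasoning
    p = σ zero
    p≢ : ∀ i → p ≢ σ (suc i)
    p≢ i = Finₚ.0≢1+n ∘ σ-inj
    τ : Fin N → Fin N
    τ i = punchOut (p≢ i)
    τ-injective : Injective _≡_ _≡_ τ
    τ-injective e = Finₚ.suc-injective (σ-inj (Finₚ.punchOut-injective (p≢ _) (p≢ _) e))

sumFin-↑ : ∀ m n (f : Fin (m + n) → ℕ) →
  sumFin f ≡ sumFin (f ∘ (_↑ˡ n)) + sumFin (f ∘ (m ↑ʳ_))
sumFin-↑ zero    n f = refl
sumFin-↑ (suc m) n f =
  trans (cong (f zero +_) (sumFin-↑ m n (f ∘ suc))) (sym (+-assoc (f zero) _ _))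

sumFin-*↔× : ∀ m n (f : Fin m × Fin n → ℕ) →
  sumFin (f ∘ Inverse.to (*↔× {m} {n})) ≡ sumFin (λ a → sumFin (λ b → f (a , b)))
sumFin-*↔× zero    n f = refl
sumFin-*↔× (suc m) n f = begin
  sumFin (f ∘ to′)
    ≡⟨ sumFin-↑ n (m * n) _ ⟩
  sumFin (f ∘ to′ ∘ (_↑ˡ m * n)) + sumFin (f ∘ to′ ∘ (n ↑ʳ_))
    ≡⟨ cong₂ _+_ (sumFin-cong (λ b → cong (f ∘ remQuot-split) (Finₚ.splitAt-↑ˡ n b (m * n))))
                 (sumFin-cong (λ i → cong (f ∘ remQuot-split) (Finₚ.splitAt-↑ʳ n (m * n) i))) ⟩
  sumFin (λ b → f (zero , b)) + sumFin (λ i → f (suc (proj₁ (to i)) , proj₂ (to i)))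
    ≡⟨ cong (sumFin (λ b → f (zero , b)) +_) (sumFin-*↔× m n (λ (a , b) → f (suc a , b))) ⟩
  sumFin (λ a → sumFin (λ b → f (a , b))) ∎
  where
    open ≡-Reasoning
    to′ = Inverse.to (*↔× {suc m} {n})
    to = Inverse.to (*↔× {m} {n})
    remQuot-split : Fin n ⊎ Fin (m * n) → Fin (suc m) × Fin n
    remQuot-split = swap ∘ [ (_, zero) , map₂ suc ∘ quotRem {m} n ]′

sumFin-χ-eqFin : ∀ {N} (y : Fin N) (f : Fin N → ℕ) → sumFin (λ j → χ (eqFin y j) * f j) ≡ f y
sumFin-χ-eqFin {suc N} y f = begin
  sumFin g
    ≡⟨ sumFin-punchIn g y ⟩
  g y + sumFin (g ∘ punchIn y)
    ≡⟨ cong₂ _+_ (cong (λ b → χ b * f y) (eqFin-refl y))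
                 (sumFin-cong (λ i → cong (λ b → χ b * f (punchIn y i)) (off i))) ⟩
  1 * f y + sumFin {N} (λ _ → 0)
    ≡⟨ cong₂ _+_ (*-identityˡ (f y)) (trans (sumFin-const {N} 0) (*-zeroʳ N)) ⟩
  f y + 0
    ≡⟨ +-identityʳ (f y) ⟩
  f y ∎
  where
    open ≡-Reasoning
    g = λ j → χ (eqFin y j) * f j
    off : ∀ i → eqFin y (punchIn y i) ≡ false
    off i = eqFin-≢ (Finₚ.punchInᵢ≢i y i ∘ sym)

countFin-true : ∀ N → countFin {N} (λ _ → true) ≡ N
countFin-true zero    = refl
countFin-true (suc N) = cong suc (countFin-true N)

countFin-singleton : ∀ {N} (p : Fin N) (R : Fin N → Bool) →
  countFin (λ j → eqFin p j ∧ R j) ≡ χ (R p)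
countFin-singleton p R = begin
  countFin (λ j → eqFin p j ∧ R j)         ≡⟨ countFin≡sumFin (λ j → eqFin p j ∧ R j) ⟩
  sumFin (λ j → χ (eqFin p j ∧ R j))       ≡⟨ sumFin-cong (λ j → χ-∧ (eqFin p j) (R j)) ⟩
  sumFin (λ j → χ (eqFin p j) * χ (R j))   ≡⟨ sumFin-χ-eqFin p (χ ∘ R) ⟩
  χ (R p)                                  ∎
  where open ≡-Reasoning

countFin-singletonˡ : ∀ {N} (p : Fin N) (R : Fin N → Bool) →
  countFin (λ j → eqFin j p ∧ R j) ≡ χ (R p)
countFin-singletonˡ p R =
  trans (countFin-cong (λ j → cong (_∧ R j) (eqFin-sym j p))) (countFin-singleton p R)

countFin-singletonʳ : ∀ {N} (p : Fin N) (R : Fin N → Bool) →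
  countFin (λ j → R j ∧ eqFin j p) ≡ χ (R p)
countFin-singletonʳ p R =
  trans (countFin-cong (λ j → ∧-comm (R j) (eqFin j p))) (countFin-singletonˡ p R)

countFin-witness : ∀ {N} (P : Fin N → Bool) → countFin P ≢ 0 → ∃[ i ] P i ≡ true
countFin-witness {zero}  P #P≢0 = ⊥-elim (#P≢0 refl)
countFin-witness {suc N} P #P≢0 with P zero in P₀
... | true  = zero , P₀
... | false = let i , Pi = countFin-witness (P ∘ suc) #P≢0 in suc i , Pi

countFin-partition : ∀ {N} (P Q : Fin N → Bool) →
  countFin (λ j → P j ∧ Q j) + countFin (λ j → P j ∧ not (Q j)) ≡ countFin P
countFin-partition P Q = begin
  countFin (λ j → P j ∧ Q j) + countFin (λ j → P j ∧ not (Q j))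
    ≡⟨ cong₂ _+_ (countFin≡sumFin (λ j → P j ∧ Q j))
                 (countFin≡sumFin (λ j → P j ∧ not (Q j))) ⟩
  sumFin (λ j → χ (P j ∧ Q j)) + sumFin (λ j → χ (P j ∧ not (Q j)))
    ≡⟨ sumFin-+ (λ j → χ (P j ∧ Q j)) (λ j → χ (P j ∧ not (Q j))) ⟨
  sumFin (λ j → χ (P j ∧ Q j) + χ (P j ∧ not (Q j)))
    ≡⟨ sumFin-cong (λ j → pointwise (P j) (Q j)) ⟩
  sumFin (χ ∘ P)
    ≡⟨ countFin≡sumFin P ⟨
  countFin P ∎
  where
    open ≡-Reasoning
    pointwise : ∀ p q → χ (p ∧ q) + χ (p ∧ not q) ≡ χ p
    pointwise true  true  = refl
    pointwise true  false = refl
    pointwise false q     = refl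

countFin-complement : ∀ {N} (P : Fin N → Bool) → countFin P + countFin (not ∘ P) ≡ N
countFin-complement {N} P = trans (countFin-partition (λ _ → true) P) (countFin-true N)

summand-≡ : ∀ {a b c a′ b′ c′ : ℕ} →
  a + b ≡ c → a′ + b′ ≡ c′ → a ≡ a′ → c ≡ c′ → b ≡ b′
summand-≡ {a} e e′ refl refl = +-cancelˡ-≡ a _ _ (trans e (sym e′))

twoPointSum : ℕ → (Bool → Bool → ℕ) → Bool → ℕ
twoPointSum N h true  = h true true + (N ∸ 1) * h false false
twoPointSum N h false = h true false + h false true + (N ∸ 2) * h false false

sumFin-twoPoint-≡ : ∀ {N} (a : Fin N) (h : Bool → Bool → ℕ) →
  sumFin (λ w → h (eqFin a w) (eqFin w a)) ≡ twoPointSum N h true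
sumFin-twoPoint-≡ {suc N} a h = begin
  sumFin g
    ≡⟨ sumFin-punchIn g a ⟩
  g a + sumFin (g ∘ punchIn a)
    ≡⟨ cong₂ _+_ (cong₂ h (eqFin-refl a) (eqFin-refl a))
                 (sumFin-cong (λ i → cong₂ h (off i) (trans (eqFin-sym _ a) (off i)))) ⟩
  h true true + sumFin {N} (λ _ → h false false)
    ≡⟨ cong (h true true +_) (sumFin-const {N} _) ⟩
  h true true + N * h false false ∎
  where
    open ≡-Reasoning
    g = λ w → h (eqFin a w) (eqFin w a)
    off : ∀ i → eqFin a (punchIn a i) ≡ false
    off i = eqFin-≢ (Finₚ.punchInᵢ≢i a i ∘ sym)

sumFin-twoPoint-≢ : ∀ {N} {a c : Fin N} (h : Bool → Bool → ℕ) → a ≢ c →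
  sumFin (λ w → h (eqFin a w) (eqFin w c)) ≡ twoPointSum N h false
sumFin-twoPoint-≢ {suc zero} {zero} {zero} h a≢c = ⊥-elim (a≢c refl)
sumFin-twoPoint-≢ {suc (suc N)} {a} {c} h a≢c = begin
  sumFin g
    ≡⟨ sumFin-punchIn g a ⟩
  g a + sumFin (g ∘ punchIn a)
    ≡⟨ cong (g a +_) (sumFin-punchIn (g ∘ punchIn a) c′) ⟩
  g a + (g (punchIn a c′) + sumFin (g ∘ punchIn a ∘ punchIn c′))
    ≡⟨ cong₂ _+_ (cong₂ h (eqFin-refl a) (eqFin-≢ a≢c))
         (cong₂ _+_ (trans (cong g a↑c′≡c) (cong₂ h (eqFin-≢ a≢c) (eqFin-refl c)))
                    (sumFin-cong (λ j → cong₂ h (eqFin-≢ (a≢ j)) (eqFin-≢ (≢c j))))) ⟩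
  h true false + (h false true + sumFin {N} (λ _ → h false false))
    ≡⟨ +-assoc (h true false) _ _ ⟨
  h true false + h false true + sumFin {N} (λ _ → h false false)
    ≡⟨ cong (h true false + h false true +_) (sumFin-const {N} _) ⟩
  h true false + h false true + N * h false false ∎
  where
    open ≡-Reasoning
    g = λ w → h (eqFin a w) (eqFin w c)
    c′ = punchOut a≢c
    a↑c′≡c : punchIn a c′ ≡ c
    a↑c′≡c = Finₚ.punchIn-punchOut a≢c
    a≢ : ∀ j → a ≢ punchIn a (punchIn c′ j)
    a≢ j = Finₚ.punchInᵢ≢i a _ ∘ sym
    ≢c : ∀ j → punchIn a (punchIn c′ j) ≢ c
    ≢c j e = Finₚ.punchInᵢ≢i c′ j (Finₚ.punchIn-injective a _ _ (trans e (sym a↑c′≡c)))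

sumFin-twoPoint : ∀ {N} (a c : Fin N) (h : Bool → Bool → ℕ) →
  sumFin (λ w → h (eqFin a w) (eqFin w c)) ≡ twoPointSum N h (eqFin a c)
sumFin-twoPoint a c h with a ≟ c
... | yes refl = sumFin-twoPoint-≡ a h
... | no a≢c   = sumFin-twoPoint-≢ h a≢c

countFin-twoPoint : ∀ {N} (a c : Fin N) (G : Bool → Bool → Bool) →
  countFin (λ w → G (eqFin a w) (eqFin w c)) ≡ twoPointSum N (λ x y → χ (G x y)) (eqFin a c)
countFin-twoPoint a c G =
  trans (countFin≡sumFin (λ w → G (eqFin a w) (eqFin w c)))
        (sumFin-twoPoint a c (λ x y → χ (G x y)))

χ-cells : ∀ (F : Bool → Bool → Bool) p q →
  χ (F p q) ≡ χ (F true true) * χ (p ∧ q) + χ (F true false) * χ (p ∧ not q)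
            + χ (F false true) * χ (not p ∧ q) + χ (F false false) * χ (not p ∧ not q)
χ-cells F p q = select p q
  where
    a = χ (F true true)
    b = χ (F true false)
    c = χ (F false true)
    d = χ (F false false)
    select : ∀ p q →
      χ (F p q) ≡ a * χ (p ∧ q) + b * χ (p ∧ not q) + c * χ (not p ∧ q) + d * χ (not p ∧ not q)
    select true  true  = solve 4 (λ a b c d → a := a :* con 1 :+ b :* con 0 :+ c :* con 0 :+ d :* con 0) refl a b c d
    select true  false = solve 4 (λ a b c d → b := a :* con 0 :+ b :* con 1 :+ c :* con 0 :+ d :* con 0) refl a b c d
    select false true  = solve 4 (λ a b c d → c := a :* con 0 :+ b :* con 0 :+ c :* con 1 :+ d :* con 0) refl a b c d
    select false false = solve 4 (λ a b c d → d := a :* con 0 :+ b :* con 0 :+ c :* con 0 :+ d :* con 1) refl a b c d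

sumFin-χ-weighted : ∀ {N} c (R : Fin N → Bool) → sumFin (λ j → c * χ (R j)) ≡ c * countFin R
sumFin-χ-weighted c R = trans (sumFin-*ˡ c (χ ∘ R)) (cong (c *_) (sym (countFin≡sumFin R)))

countFin-cells : ∀ {N} (F : Bool → Bool → Bool) (P Q : Fin N → Bool) →
  countFin (λ j → F (P j) (Q j)) ≡
    χ (F true true) * countFin (λ j → P j ∧ Q j)
    + χ (F true false) * countFin (λ j → P j ∧ not (Q j))
    + χ (F false true) * countFin (λ j → not (P j) ∧ Q j)
    + χ (F false false) * countFin (λ j → not (P j) ∧ not (Q j))
countFin-cells F P Q = begin
  countFin (λ j → F (P j) (Q j))
    ≡⟨ countFin≡sumFin (λ j → F (P j) (Q j)) ⟩
  sumFin (λ j → χ (F (P j) (Q j)))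
    ≡⟨ sumFin-cong (λ j → χ-cells F (P j) (Q j)) ⟩
  sumFin (λ j → c₁ j + c₂ j + c₃ j + c₄ j)
    ≡⟨ sumFin-+ (λ j → c₁ j + c₂ j + c₃ j) c₄ ⟩
  sumFin (λ j → c₁ j + c₂ j + c₃ j) + sumFin c₄
    ≡⟨ cong (_+ sumFin c₄) (trans (sumFin-+ (λ j → c₁ j + c₂ j) c₃)
                                  (cong (_+ sumFin c₃) (sumFin-+ c₁ c₂))) ⟩
  sumFin c₁ + sumFin c₂ + sumFin c₃ + sumFin c₄
    ≡⟨ cong₂ _+_ (cong₂ _+_ (cong₂ _+_ (sumFin-χ-weighted (χ (F true true)) (λ j → P j ∧ Q j))
                                        (sumFin-χ-weighted (χ (F true false)) (λ j → P j ∧ not (Q j))))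
                             (sumFin-χ-weighted (χ (F false true)) (λ j → not (P j) ∧ Q j)))
                 (sumFin-χ-weighted (χ (F false false)) (λ j → not (P j) ∧ not (Q j))) ⟩
  _ ∎
  where
    open ≡-Reasoning
    c₁ = λ j → χ (F true true) * χ (P j ∧ Q j)
    c₂ = λ j → χ (F true false) * χ (P j ∧ not (Q j))
    c₃ = λ j → χ (F false true) * χ (not (P j) ∧ Q j)
    c₄ = λ j → χ (F false false) * χ (not (P j) ∧ not (Q j))

-- The four cells of the partition by P and Q are determined by |P|, |Q| and |P ∧ Q|.
countFin-cells-cong : ∀ {N} (P₁ Q₁ P₂ Q₂ : Fin N → Bool) →
  countFin P₁ ≡ countFin P₂ → countFin Q₁ ≡ countFin Q₂ →
  countFin (λ j → P₁ j ∧ Q₁ j) ≡ countFin (λ j → P₂ j ∧ Q₂ j) →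
  ∀ F → countFin (λ j → F (P₁ j) (Q₁ j)) ≡ countFin (λ j → F (P₂ j) (Q₂ j))
countFin-cells-cong {N} P₁ Q₁ P₂ Q₂ #P #Q #PQ F = begin
  countFin (λ j → F (P₁ j) (Q₁ j))
    ≡⟨ countFin-cells F P₁ Q₁ ⟩
  _ ≡⟨ cong₂ _+_ (cong₂ _+_ (cong₂ _+_ (cong (χ (F true true) *_) #PQ)
                                      (cong (χ (F true false) *_) #P¬Q))
                           (cong (χ (F false true) *_) #¬PQ))
                 (cong (χ (F false false) *_) #¬P¬Q) ⟩
  _ ≡⟨ countFin-cells F P₂ Q₂ ⟨
  countFin (λ j → F (P₂ j) (Q₂ j)) ∎
  where
    open ≡-Reasoning
    ∧-comm-count : ∀ (P Q : Fin N → Bool) →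
      countFin (λ j → P j ∧ Q j) ≡ countFin (λ j → Q j ∧ P j)
    ∧-comm-count P Q = countFin-cong (λ j → ∧-comm (P j) (Q j))
    #P¬Q = summand-≡ (countFin-partition P₁ Q₁) (countFin-partition P₂ Q₂) #PQ #P
    #Q¬P = summand-≡ (countFin-partition Q₁ P₁) (countFin-partition Q₂ P₂)
             (trans (∧-comm-count Q₁ P₁) (trans #PQ (∧-comm-count P₂ Q₂))) #Q
    #¬PQ = trans (∧-comm-count (not ∘ P₁) Q₁) (trans #Q¬P (∧-comm-count Q₂ (not ∘ P₂)))
    #¬P = summand-≡ (countFin-complement P₁) (countFin-complement P₂) #P refl
    #¬P¬Q = summand-≡ (countFin-partition (not ∘ P₁) Q₁) (countFin-partition (not ∘ P₂) Q₂)
              #¬PQ #¬P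

countFin-colours : ∀ {N r} (a b : Fin N → Fin r) (F : Fin r → Fin r → Bool) →
  countFin (λ w → F (a w) (b w)) ≡
    sumFin (λ i → sumFin (λ j → χ (F i j) * countFin (λ w → eqFin (a w) i ∧ eqFin (b w) j)))
countFin-colours {N} {r} a b F = begin
  countFin (λ w → F (a w) (b w))
    ≡⟨ countFin≡sumFin (λ w → F (a w) (b w)) ⟩
  sumFin (λ w → χ (F (a w) (b w)))
    ≡⟨ sumFin-cong (λ w → pointwise (a w) (b w)) ⟨
  sumFin (λ w → sumFin (λ i → sumFin (λ j → g w i j)))
    ≡⟨ sumFin-swap (λ w i → sumFin (g w i)) ⟩
  sumFin (λ i → sumFin (λ w → sumFin (λ j → g w i j)))
    ≡⟨ sumFin-cong (λ i → sumFin-swap (λ w j → g w i j)) ⟩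
  sumFin (λ i → sumFin (λ j → sumFin (λ w → g w i j)))
    ≡⟨ sumFin-cong (λ i → sumFin-cong (λ j →
         sumFin-χ-weighted (χ (F i j)) (λ w → eqFin (a w) i ∧ eqFin (b w) j))) ⟩
  sumFin (λ i → sumFin (λ j → χ (F i j) * countFin (λ w → eqFin (a w) i ∧ eqFin (b w) j))) ∎
  where
    open ≡-Reasoning
    g : Fin N → Fin r → Fin r → ℕ
    g w i j = χ (F i j) * χ (eqFin (a w) i ∧ eqFin (b w) j)
    rearrange : ∀ x y z → z * (x * y) ≡ x * (y * z)
    rearrange = solve 3 (λ x y z → z :* (x :* y) := x :* (y :* z)) refl
    pointwise : ∀ x y →
      sumFin (λ i → sumFin (λ j → χ (F i j) * χ (eqFin x i ∧ eqFin y j))) ≡ χ (F x y)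
    pointwise x y = begin
      sumFin (λ i → sumFin (λ j → χ (F i j) * χ (eqFin x i ∧ eqFin y j)))
        ≡⟨ sumFin-cong (λ i → sumFin-cong (λ j →
             trans (cong (χ (F i j) *_) (χ-∧ (eqFin x i) (eqFin y j)))
                   (rearrange (χ (eqFin x i)) (χ (eqFin y j)) (χ (F i j))))) ⟩
      sumFin (λ i → sumFin (λ j → χ (eqFin x i) * (χ (eqFin y j) * χ (F i j))))
        ≡⟨ sumFin-cong (λ i →
             trans (sumFin-*ˡ (χ (eqFin x i)) (λ j → χ (eqFin y j) * χ (F i j)))
                   (cong (χ (eqFin x i) *_) (sumFin-χ-eqFin y (λ j → χ (F i j))))) ⟩
      sumFin (λ i → χ (eqFin x i) * χ (F i y))
        ≡⟨ sumFin-χ-eqFin x (λ i → χ (F i y)) ⟩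
      χ (F x y) ∎

countFin-∘-injective : ∀ {N} (P : Fin N → Bool) {σ : Fin N → Fin N} →
  Injective _≡_ _≡_ σ → countFin (P ∘ σ) ≡ countFin P
countFin-∘-injective P {σ} σ-inj =
  trans (countFin≡sumFin (P ∘ σ))
        (trans (sumFin-∘-injective (χ ∘ P) σ-inj) (sym (countFin≡sumFin P)))

module _ (Γ : Graph) where
  open Graph Γ

  countV-∘-injective : (P : V → Bool) {φ : V → V} → Injective _≡_ _≡_ φ →
    countV Γ (P ∘ φ) ≡ countV Γ P
  countV-∘-injective P {φ} φ-inj = begin
    countFin (P ∘ φ ∘ to)
      ≡⟨ countFin-cong (λ i → cong P (sym (Inverse.strictlyInverseˡ enum (φ (to i))))) ⟩
    countFin (P ∘ to ∘ from ∘ φ ∘ to)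
      ≡⟨ countFin-∘-injective (P ∘ to) σ-inj ⟩
    countFin (P ∘ to) ∎
    where
      open ≡-Reasoning
      to = Inverse.to enum
      from = Inverse.from enum
      σ-inj : Injective _≡_ _≡_ (from ∘ φ ∘ to)
      σ-inj = Injection.injective (↔⇒↣ enum) ∘ φ-inj ∘ Injection.injective (↔⇒↣ (↔-sym enum))

  commonNbrs-self : (∀ u v → adj u v ≡ adj v u) → ∀ u → commonNbrs Γ u u ≡ degree Γ u
  commonNbrs-self adj-sym u =
    countFin-cong (λ i → trans (cong (adj u (to i) ∧_) (adj-sym (to i) u))
                               (∧-idem _))
    where to = Inverse.to enum

  -- Common neighbours are counted by intersection numbers of the edge classes.
  commonNbrs-invariant : ∀ {r} (c : V → V → Fin r) →
    IsCoherentConfig Γ c → EdgesUnionOfClasses Γ c →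
    ∀ {u v u′ v′} → c u v ≡ c u′ v′ → commonNbrs Γ u v ≡ commonNbrs Γ u′ v′
  commonNbrs-invariant {r} c cc edges {u} {v} {u′} {v′} c≡ =
    trans (byColours u v)
      (trans (sumFin-cong (λ i → sumFin-cong (λ j →
                cong (χ (isEdge i ∧ isEdge j) *_) (interNum u v u′ v′ c≡ i j))))
             (sym (byColours u′ v′)))
    where
      open IsCoherentConfig cc
      to = Inverse.to enum
      isEdge : Fin r → Bool
      isEdge i = let (x , y , _) = surj i in adj x y
      adj-isEdge : ∀ x y → adj x y ≡ isEdge (c x y)
      adj-isEdge x y = sym (edges _ _ x y (proj₂ (proj₂ (surj (c x y)))))
      byColours : ∀ x y → commonNbrs Γ x y ≡ sumFin (λ i → sumFin (λ j →
        χ (isEdge i ∧ isEdge j) * countV Γ (λ w → eqFin (c x w) i ∧ eqFin (c w y) j)))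
      byColours x y =
        trans (countFin-cong (λ w → cong₂ _∧_ (adj-isEdge x (to w)) (adj-isEdge (to w) y)))
              (countFin-colours (λ w → c x (to w)) (λ w → c (to w) y) (λ i j → isEdge i ∧ isEdge j))

-- Strictly Deza graphs of WL-rank 4 from four-class colourings

pattern 0F = zero
pattern 1F = suc zero
pattern 2F = suc (suc zero)
pattern 3F = suc (suc (suc zero))

isEdgeColour : Fin 4 → Bool
isEdgeColour 0F = false
isEdgeColour 1F = true
isEdgeColour 2F = true
isEdgeColour 3F = false

-- Colour 0 is the diagonal, colours 1 and 2 are the edges, colour 3 the non-edges.
record DezaColouring (Γ : Graph) : Set where
  open Graph Γ
  field
    colour               : V → V → Fin 4
    colour-refl          : ∀ u → colour u u ≡ 0F
    colour≡0F⇒≡          : ∀ {u v} → colour u v ≡ 0F → u ≡ v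
    colour-sym           : ∀ u v → colour v u ≡ colour u v
    adj-colour           : ∀ u v → adj u v ≡ isEdgeColour (colour u v)
    colour-surjective    : ∀ i → ∃[ u ] ∃[ v ] colour u v ≡ i
    intersection-numbers : ∀ u v u′ v′ → colour u v ≡ colour u′ v′ → ∀ i j →
      countV Γ (λ w → eqFin (colour u w) i ∧ eqFin (colour w v) j)
        ≡ countV Γ (λ w → eqFin (colour u′ w) i ∧ eqFin (colour w v′) j)
    μ                    : Fin 4 → ℕ
    commonNbrs-colour    : ∀ u v → commonNbrs Γ u v ≡ μ (colour u v)
    μ₁≢μ₂                : μ 1F ≢ μ 2F
    μ₃≡μ₁⊎μ₃≡μ₂          : μ 3F ≡ μ 1F ⊎ μ 3F ≡ μ 2F
    μ₃≢0                 : μ 3F ≢ 0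

module _ {Γ : Graph} (C : DezaColouring Γ) where
  open Graph Γ
  open DezaColouring C

  adj-sym : ∀ u v → adj u v ≡ adj v u
  adj-sym u v =
    trans (adj-colour u v) (sym (trans (adj-colour v u) (cong isEdgeColour (colour-sym u v))))

  colour≡3F : ∀ {u v} → u ≢ v → adj u v ≡ false → colour u v ≡ 3F
  colour≡3F {u} {v} u≢v ¬adj =
    nonEdge (colour u v) (u≢v ∘ colour≡0F⇒≡) (trans (sym (adj-colour u v)) ¬adj)
    where
      nonEdge : ∀ i → i ≢ 0F → isEdgeColour i ≡ false → i ≡ 3F
      nonEdge 0F i≢0 _ = ⊥-elim (i≢0 refl)
      nonEdge 3F _   _ = refl

  colour≢0F⇒≢ : ∀ {u v} → colour u v ≢ 0F → u ≢ v
  colour≢0F⇒≢ {u} c≢0 refl = c≢0 (colour-refl u)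

  isDeza : IsDeza Γ
  isDeza = μ 0F , μ 2F , μ 1F , regular , offDiagonal
    where
      regular : IsRegular Γ (μ 0F)
      regular u = trans (sym (commonNbrs-self Γ adj-sym u))
                        (trans (commonNbrs-colour u u) (cong μ (colour-refl u)))
      μ-offDiagonal : ∀ i → i ≢ 0F → μ i ≡ μ 1F ⊎ μ i ≡ μ 2F
      μ-offDiagonal 0F i≢0 = ⊥-elim (i≢0 refl)
      μ-offDiagonal 1F _   = inj₁ refl
      μ-offDiagonal 2F _   = inj₂ refl
      μ-offDiagonal 3F _   = μ₃≡μ₁⊎μ₃≡μ₂
      offDiagonal : ∀ u v → u ≢ v → commonNbrs Γ u v ≡ μ 1F ⊎ commonNbrs Γ u v ≡ μ 2F
      offDiagonal u v u≢v rewrite commonNbrs-colour u v =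
        μ-offDiagonal (colour u v) (u≢v ∘ colour≡0F⇒≡)

  ¬stronglyRegular : ¬ IsStronglyRegular Γ
  ¬stronglyRegular (_ , λ′ , _ , _ , adj⇒λ′ , _) =
    μ₁≢μ₂ (trans (μ-edge 1F refl) (sym (μ-edge 2F refl)))
    where
      μ-edge : ∀ i → isEdgeColour i ≡ true → μ i ≡ λ′
      μ-edge i edge = let (u , v , uv≡i) = colour-surjective i in
        trans (cong μ (sym uv≡i)) (trans (sym (commonNbrs-colour u v))
          (adj⇒λ′ u v (trans (adj-colour u v) (trans (cong isEdgeColour uv≡i) edge))))

  hasDiameter2 : HasDiameter2 Γ
  hasDiameter2 =
    path₂ , (u , v , colour≢0F⇒≢ (λ uv≡0 → 3F≢0F (trans (sym uv≡3) uv≡0)) ,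
             trans (adj-colour u v) (cong isEdgeColour uv≡3))
    where
      3F≢0F : 3F ≢ 0F
      3F≢0F ()
      uv = colour-surjective 3F
      u = proj₁ uv
      v = proj₁ (proj₂ uv)
      uv≡3 = proj₂ (proj₂ uv)
      ∧-true : ∀ {a b} → a ∧ b ≡ true → a ≡ true × b ≡ true
      ∧-true {true} {true} _ = refl , refl
      path₂ : ∀ u v → u ≢ v → adj u v ≡ false → ∃[ w ] (adj u w ≡ true × adj w v ≡ true)
      path₂ u v u≢v ¬adj =
        let cn≡μ₃ = trans (commonNbrs-colour u v) (cong μ (colour≡3F u≢v ¬adj))
            (i , adj²) = countFin-witness _ (μ₃≢0 ∘ trans (sym cn≡μ₃))
        in Inverse.to enum i , ∧-true adj²

  colour-determined : ∀ i j → (i ≡ 0F → j ≡ 0F) → (j ≡ 0F → i ≡ 0F) →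
    isEdgeColour i ≡ isEdgeColour j → μ i ≡ μ j → i ≡ j
  colour-determined 0F      j  i⇒j _   _  _  = sym (i⇒j refl)
  colour-determined (suc i) 0F _   j⇒i _  _  = j⇒i refl
  colour-determined 1F      1F _   _   _  _  = refl
  colour-determined 2F      2F _   _   _  _  = refl
  colour-determined 3F      3F _   _   _  _  = refl
  colour-determined 1F      2F _   _   _  μ≡ = ⊥-elim (μ₁≢μ₂ μ≡)
  colour-determined 2F      1F _   _   _  μ≡ = ⊥-elim (μ₁≢μ₂ (sym μ≡))
  colour-determined 1F      3F _   _   () _
  colour-determined 2F      3F _   _   () _
  colour-determined 3F      1F _   _   () _
  colour-determined 3F      2F _   _   () _

  isCoherentConfig : IsCoherentConfig Γ colour
  isCoherentConfig = record
    { surj     = colour-surjective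
    ; diag     = λ u v w uu≡vw → colour≡0F⇒≡ (trans (sym uu≡vw) (colour-refl u))
    ; transp   = λ u v u′ v′ e → trans (colour-sym u v) (trans e (sym (colour-sym u′ v′)))
    ; interNum = intersection-numbers
    }

  edgesUnionOfClasses : EdgesUnionOfClasses Γ colour
  edgesUnionOfClasses u v u′ v′ e =
    trans (adj-colour u v) (trans (cong isEdgeColour e) (sym (adj-colour u′ v′)))

  coarsest : ∀ {r′} (c′ : V → V → Fin r′) →
    IsCoherentConfig Γ c′ → EdgesUnionOfClasses Γ c′ →
    ∀ u v u′ v′ → c′ u v ≡ c′ u′ v′ → colour u v ≡ colour u′ v′
  coarsest c′ cc′ edges′ u v u′ v′ c′≡ = colour-determined (colour u v) (colour u′ v′)
    (diagonal-transfer c′≡) (diagonal-transfer (sym c′≡))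
    (trans (sym (adj-colour u v)) (trans (edges′ u v u′ v′ c′≡) (adj-colour u′ v′)))
    (trans (sym (commonNbrs-colour u v))
           (trans (commonNbrs-invariant Γ c′ cc′ edges′ c′≡) (commonNbrs-colour u′ v′)))
    where
      diagonal-transfer : ∀ {x y x′ y′} →
        c′ x y ≡ c′ x′ y′ → colour x y ≡ 0F → colour x′ y′ ≡ 0F
      diagonal-transfer {x} {y} {x′} {y′} c′≡ xy≡0 with colour≡0F⇒≡ xy≡0
      ... | refl with IsCoherentConfig.diag cc′ x x′ y′ c′≡
      ... | refl = colour-refl x′

  isStrictlyDeza×hasWLRank4 : IsStrictlyDeza Γ × HasWLRank Γ 4
  isStrictlyDeza×hasWLRank4 =
    (isDeza , ¬stronglyRegular , hasDiameter2) ,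
    (colour , isCoherentConfig , edgesUnionOfClasses , coarsest)

rook : Bool → Bool → Bool
rook x y = (x ∧ not y) ∨ (y ∧ not x)

countV-KK : ∀ {a b} (u₁ v₁ : Fin a) (u₂ v₂ : Fin b) (G : Bool → Bool → Bool → Bool → Bool) →
  countV (KK a b) (λ (w₁ , w₂) → G (eqFin u₁ w₁) (eqFin w₁ v₁) (eqFin u₂ w₂) (eqFin w₂ v₂))
    ≡ twoPointSum a (λ x y → twoPointSum b (λ p q → χ (G x y p q)) (eqFin u₂ v₂)) (eqFin u₁ v₁)
countV-KK {a} {b} u₁ v₁ u₂ v₂ G = begin
  countFin (P ∘ Inverse.to *↔×)
    ≡⟨ countFin≡sumFin (P ∘ Inverse.to *↔×) ⟩
  sumFin (χ ∘ P ∘ Inverse.to *↔×)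
    ≡⟨ sumFin-*↔× a b (χ ∘ P) ⟩
  sumFin (λ w₁ → sumFin (λ w₂ → χ (P (w₁ , w₂))))
    ≡⟨ sumFin-cong (λ w₁ →
         sumFin-twoPoint u₂ v₂ (λ p q → χ (G (eqFin u₁ w₁) (eqFin w₁ v₁) p q))) ⟩
  sumFin (λ w₁ → twoPointSum b (λ p q → χ (G (eqFin u₁ w₁) (eqFin w₁ v₁) p q)) (eqFin u₂ v₂))
    ≡⟨ sumFin-twoPoint u₁ v₁ (λ x y → twoPointSum b (λ p q → χ (G x y p q)) (eqFin u₂ v₂)) ⟩
  twoPointSum a (λ x y → twoPointSum b (λ p q → χ (G x y p q)) (eqFin u₂ v₂)) (eqFin u₁ v₁) ∎
  where
    open ≡-Reasoning
    P : Fin a × Fin b → Bool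
    P (w₁ , w₂) = G (eqFin u₁ w₁) (eqFin w₁ v₁) (eqFin u₂ w₂) (eqFin w₂ v₂)

rookColour : Bool → Bool → Fin 4
rookColour true  true  = 0F
rookColour true  false = 1F
rookColour false true  = 2F
rookColour false false = 3F

rookPosition : Fin 4 → Bool × Bool
rookPosition 0F = true  , true
rookPosition 1F = true  , false
rookPosition 2F = false , true
rookPosition 3F = false , false

rookPosition-rookColour : ∀ x y → rookPosition (rookColour x y) ≡ (x , y)
rookPosition-rookColour true  true  = refl
rookPosition-rookColour true  false = refl
rookPosition-rookColour false true  = refl
rookPosition-rookColour false false = refl

isEdgeColour-rookColour : ∀ x y → isEdgeColour (rookColour x y) ≡ rook x y
isEdgeColour-rookColour true  true  = refl
isEdgeColour-rookColour true  false = refl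
isEdgeColour-rookColour false true  = refl
isEdgeColour-rookColour false false = refl

module RookGraph (a b : ℕ) where

  colour : Fin a × Fin b → Fin a × Fin b → Fin 4
  colour (u₁ , u₂) (v₁ , v₂) = rookColour (eqFin u₁ v₁) (eqFin u₂ v₂)

  colour≡0F⇒≡ : ∀ u v → colour u v ≡ 0F → u ≡ v
  colour≡0F⇒≡ (u₁ , u₂) (v₁ , v₂) c≡0 =
    let e = trans (sym (rookPosition-rookColour (eqFin u₁ v₁) (eqFin u₂ v₂))) (cong rookPosition c≡0) in
    cong₂ _,_ (eqFin-true (cong proj₁ e)) (eqFin-true (cong proj₂ e))

  commonCount : Bool → Bool → ℕ
  commonCount x y = twoPointSum a (λ p q → twoPointSum b (λ r s → χ (rook p r ∧ rook q s)) y) x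

  μ : Fin 4 → ℕ
  μ = uncurry commonCount ∘ rookPosition

  commonNbrs-colour : ∀ u v → commonNbrs (KK a b) u v ≡ μ (colour u v)
  commonNbrs-colour (u₁ , u₂) (v₁ , v₂) =
    trans (countV-KK u₁ v₁ u₂ v₂ (λ x y p q → rook x p ∧ rook y q))
          (cong (uncurry commonCount) (sym (rookPosition-rookColour (eqFin u₁ v₁) (eqFin u₂ v₂))))

  intersectionCount : Fin 4 → Fin 4 → Bool × Bool → ℕ
  intersectionCount i j (x , y) = twoPointSum a (λ p q →
    twoPointSum b (λ r s → χ (eqFin (rookColour p r) i ∧ eqFin (rookColour q s) j)) y) x

  intersections : ∀ u v i j → countV (KK a b) (λ w → eqFin (colour u w) i ∧ eqFin (colour w v) j)
                                ≡ intersectionCount i j (rookPosition (colour u v))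
  intersections (u₁ , u₂) (v₁ , v₂) i j =
    trans (countV-KK u₁ v₁ u₂ v₂ (λ x y p q → eqFin (rookColour x p) i ∧ eqFin (rookColour y q) j))
          (cong (intersectionCount i j) (sym (rookPosition-rookColour (eqFin u₁ v₁) (eqFin u₂ v₂))))

rookColouring : ∀ m → 2 ≤ m → m ≢ 4 → DezaColouring (KK 4 m)
rookColouring 1 (s≤s ()) _
rookColouring (suc (suc m′)) _ m≢4 = record
  { colour               = colour
  ; colour-refl          = λ (u₁ , u₂) → cong₂ rookColour (eqFin-refl u₁) (eqFin-refl u₂)
  ; colour≡0F⇒≡          = λ {u} {v} → colour≡0F⇒≡ u v
  ; colour-sym           = λ (u₁ , u₂) (v₁ , v₂) →
                             cong₂ rookColour (eqFin-sym v₁ u₁) (eqFin-sym v₂ u₂)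
  ; adj-colour           = λ (u₁ , u₂) (v₁ , v₂) →
                             sym (isEdgeColour-rookColour (eqFin u₁ v₁) (eqFin u₂ v₂))
  ; colour-surjective    = λ { 0F → (zero , zero) , (zero , zero) , refl
                             ; 1F → (zero , zero) , (zero , suc zero) , refl
                             ; 2F → (zero , zero) , (suc zero , zero) , refl
                             ; 3F → (zero , zero) , (suc zero , suc zero) , refl }
  ; intersection-numbers = λ u v u′ v′ c≡ i j →
                             trans (intersections u v i j)
                               (trans (cong (intersectionCount i j ∘ rookPosition) c≡)
                                      (sym (intersections u′ v′ i j)))
  ; μ                    = μ
  ; commonNbrs-colour    = commonNbrs-colour
  ; μ₁≢μ₂                = λ μ₁≡μ₂ →
                             m≢4 (cong (λ k → suc (suc k)) (trans (sym μ₁≡m′) (trans μ₁≡μ₂ μ₂≡2)))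
  ; μ₃≡μ₁⊎μ₃≡μ₂          = inj₂ (trans μ₃≡2 (sym μ₂≡2))
  ; μ₃≢0                 = 1+n≢0 ∘ trans (sym μ₃≡2)
  }
  where
    open RookGraph 4 (suc (suc m′))
    μ₁≡m′ : μ 1F ≡ m′
    μ₁≡m′ = solve 1 (λ k → k :* con 1 :+ con 3 :* (k :* con 0) := k) refl m′
    μ₂≡2 : μ 2F ≡ 2
    μ₂≡2 = solve 1 (λ k → k :* con 0 :+ k :* con 0 :+ con 2 :* (con 1 :+ k :* con 0) := con 2)
             refl (suc m′)
    μ₃≡2 : μ 3F ≡ 2
    μ₃≡2 = solve 1 (λ k → con 1 :+ k :* con 0 :+ (con 1 :+ k :* con 0) :+ con 2 :* (k :* con 0) := con 2)
             refl m′

isGroup-≡ : ∀ {A : Set} {_∙_ : Op₂ A} {ε : A} {_⁻¹ : Op₁ A} →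
  Associative _≡_ _∙_ → Identity _≡_ ε _∙_ → AlgDef.Inverse _≡_ ε _⁻¹ _∙_ →
  IsGroup _≡_ _∙_ ε _⁻¹
isGroup-≡ {_∙_ = _∙_} {_⁻¹ = _⁻¹} assoc identity inverse = record
  { isMonoid = record
    { isSemigroup = record
      { isMagma = record { isEquivalence = isEquivalence ; ∙-cong = cong₂ _∙_ }
      ; assoc   = assoc }
    ; identity = identity }
  ; inverse = inverse
  ; ⁻¹-cong = cong _⁻¹ }

module _ {n : ℕ} {{_ : NonZero n}} where

  toℕ-mod : ∀ x → toℕ (x mod n) ≡ x % n
  toℕ-mod x = Finₚ.toℕ-fromℕ< (m%n<n x n)

  toℕ-0ₙ : toℕ (0ₙ {n}) ≡ 0
  toℕ-0ₙ = trans (toℕ-mod 0) (m<n⇒m%n≡m (>-nonZero⁻¹ n))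

  toℕ-+ₙ : ∀ (i j : Fin n) → toℕ (i +ₙ j) ≡ (toℕ i + toℕ j) % n
  toℕ-+ₙ i j = toℕ-mod (toℕ i + toℕ j)

  toℕ%n : ∀ (i : Fin n) → toℕ i % n ≡ toℕ i
  toℕ%n i = m<n⇒m%n≡m (Finₚ.toℕ<n i)

  %-absorbˡ : ∀ x y → (x % n + y) % n ≡ (x + y) % n
  %-absorbˡ x y = begin
    (x % n + y) % n          ≡⟨ %-distribˡ-+ (x % n) y n ⟩
    (x % n % n + y % n) % n  ≡⟨ cong (λ z → (z + y % n) % n) (m%n%n≡m%n x n) ⟩
    (x % n + y % n) % n      ≡⟨ %-distribˡ-+ x y n ⟨
    (x + y) % n              ∎
    where open ≡-Reasoning

  %-absorbʳ : ∀ x y → (x + y % n) % n ≡ (x + y) % n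
  %-absorbʳ x y =
    trans (cong (_% n) (+-comm x (y % n))) (trans (%-absorbˡ y x) (cong (_% n) (+-comm y x)))

  +ₙ-assoc : Associative _≡_ (_+ₙ_ {n})
  +ₙ-assoc i j k = Finₚ.toℕ-injective (begin
    toℕ ((i +ₙ j) +ₙ k)                ≡⟨ toℕ-+ₙ (i +ₙ j) k ⟩
    (toℕ (i +ₙ j) + toℕ k) % n         ≡⟨ cong (λ z → (z + toℕ k) % n) (toℕ-+ₙ i j) ⟩
    ((toℕ i + toℕ j) % n + toℕ k) % n  ≡⟨ %-absorbˡ (toℕ i + toℕ j) (toℕ k) ⟩
    (toℕ i + toℕ j + toℕ k) % n        ≡⟨ cong (_% n) (+-assoc (toℕ i) (toℕ j) (toℕ k)) ⟩
    (toℕ i + (toℕ j + toℕ k)) % n      ≡⟨ %-absorbʳ (toℕ i) (toℕ j + toℕ k) ⟨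
    (toℕ i + (toℕ j + toℕ k) % n) % n  ≡⟨ cong (λ z → (toℕ i + z) % n) (toℕ-+ₙ j k) ⟨
    (toℕ i + toℕ (j +ₙ k)) % n         ≡⟨ toℕ-+ₙ i (j +ₙ k) ⟨
    toℕ (i +ₙ (j +ₙ k))                ∎)
    where open ≡-Reasoning

  +ₙ-comm : Commutative _≡_ (_+ₙ_ {n})
  +ₙ-comm i j = cong (_mod n) (+-comm (toℕ i) (toℕ j))

  +ₙ-identityˡ : LeftIdentity _≡_ 0ₙ (_+ₙ_ {n})
  +ₙ-identityˡ i = Finₚ.toℕ-injective
    (trans (toℕ-+ₙ 0ₙ i) (trans (cong (λ z → (z + toℕ i) % n) toℕ-0ₙ) (toℕ%n i)))

  +ₙ-inverseʳ : RightInverse _≡_ 0ₙ -ₙ_ (_+ₙ_ {n})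
  +ₙ-inverseʳ i = Finₚ.toℕ-injective (begin
    toℕ (i +ₙ (-ₙ i))              ≡⟨ toℕ-+ₙ i (-ₙ i) ⟩
    (toℕ i + toℕ (-ₙ i)) % n       ≡⟨ cong (λ z → (toℕ i + z) % n) (toℕ-mod (n ∸ toℕ i)) ⟩
    (toℕ i + (n ∸ toℕ i) % n) % n  ≡⟨ %-absorbʳ (toℕ i) (n ∸ toℕ i) ⟩
    (toℕ i + (n ∸ toℕ i)) % n      ≡⟨ cong (_% n) (m+[n∸m]≡n (<⇒≤ (Finₚ.toℕ<n i))) ⟩
    n % n                          ≡⟨ n%n≡0 n ⟩
    0                              ≡⟨ toℕ-0ₙ ⟨
    toℕ (0ₙ {n})                   ∎)
    where open ≡-Reasoning

  ℤ/n : AbelianGroup 0ℓ 0ℓ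
  ℤ/n = record
    { isAbelianGroup = record
      { isGroup = isGroup-≡ +ₙ-assoc
                    (+ₙ-identityˡ , λ i → trans (+ₙ-comm i 0ₙ) (+ₙ-identityˡ i))
                    ((λ i → trans (+ₙ-comm (-ₙ i) i) (+ₙ-inverseʳ i)) , +ₙ-inverseʳ)
      ; comm    = +ₙ-comm } }

module ℤₙ {n : ℕ} {{_ : NonZero n}} where
  open AbelianGroup (ℤ/n {n}) public
  open AbelianGroupProperties (ℤ/n {n}) public

module _ {n : ℕ} {{_ : NonZero n}} where

  -ₙ-distrib : ∀ (i j k : Fin n) → (-ₙ (i +ₙ j)) +ₙ k ≡ (-ₙ i) +ₙ ((-ₙ j) +ₙ k)
  -ₙ-distrib i j k = trans (cong (_+ₙ k) (sym (ℤₙ.⁻¹-∙-comm i j))) (+ₙ-assoc (-ₙ i) (-ₙ j) k)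

  ·-assoc : Associative _≡_ (_·_ {n})
  ·-assoc (0F , i) (0F , j) (0F , k) = cong (0F ,_) (+ₙ-assoc i j k)
  ·-assoc (0F , i) (1F , j) (0F , k) = cong (1F ,_) (+ₙ-assoc (-ₙ i) j k)
  ·-assoc (1F , i) (0F , j) (0F , k) = cong (1F ,_) (+ₙ-assoc i j k)
  ·-assoc (1F , i) (1F , j) (0F , k) = cong (0F ,_) (+ₙ-assoc (-ₙ i) j k)
  ·-assoc (0F , i) (0F , j) (1F , k) = cong (1F ,_) (-ₙ-distrib i j k)
  ·-assoc (1F , i) (0F , j) (1F , k) = cong (0F ,_) (-ₙ-distrib i j k)
  ·-assoc (0F , i) (1F , j) (1F , k) =
    cong (0F ,_) (trans (-ₙ-distrib (-ₙ i) j k) (cong (_+ₙ _) (ℤₙ.⁻¹-involutive i)))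
  ·-assoc (1F , i) (1F , j) (1F , k) =
    cong (1F ,_) (trans (-ₙ-distrib (-ₙ i) j k) (cong (_+ₙ _) (ℤₙ.⁻¹-involutive i)))

  ·-identityˡ : LeftIdentity _≡_ eD (_·_ {n})
  ·-identityˡ (0F , i) = cong (0F ,_) (ℤₙ.identityˡ i)
  ·-identityˡ (1F , i) = cong (1F ,_) (trans (cong (_+ₙ i) ℤₙ.ε⁻¹≈ε) (ℤₙ.identityˡ i))

  ·-identityʳ : RightIdentity _≡_ eD (_·_ {n})
  ·-identityʳ (0F , i) = cong (0F ,_) (ℤₙ.identityʳ i)
  ·-identityʳ (1F , i) = cong (1F ,_) (ℤₙ.identityʳ i)

  ·-inverseˡ : LeftInverse _≡_ eD _⁻¹ (_·_ {n})
  ·-inverseˡ (0F , i) = cong (0F ,_) (ℤₙ.inverseˡ i)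
  ·-inverseˡ (1F , i) = cong (0F ,_) (ℤₙ.inverseˡ i)

  ·-inverseʳ : RightInverse _≡_ eD _⁻¹ (_·_ {n})
  ·-inverseʳ (0F , i) = cong (0F ,_) (ℤₙ.inverseʳ i)
  ·-inverseʳ (1F , i) = cong (0F ,_) (ℤₙ.inverseˡ i)

  Dih-group : Group 0ℓ 0ℓ
  Dih-group = record
    { _∙_     = _·_
    ; ε       = eD
    ; _⁻¹     = _⁻¹
    ; isGroup = isGroup-≡ ·-assoc (·-identityˡ , ·-identityʳ) (·-inverseˡ , ·-inverseʳ) }

module Dₙ {n : ℕ} {{_ : NonZero n}} where
  open Group (Dih-group {n}) public
  open GroupProperties (Dih-group {n}) public

module _ {n : ℕ} {{nz : NonZero n}} where
  isDihedrant-Cay : 3 ≤ n → ∀ {S} → IsConnectionSet S → IsDihedrant (Cay S)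
  isDihedrant-Cay 3≤n {S} conn = n , nz , 3≤n , S , conn , ↔-id _ , λ _ _ → refl

  ·eD⁻¹ : ∀ (g : Dih n) → g · (eD ⁻¹) ≡ g
  ·eD⁻¹ g = trans (cong (g ·_) Dₙ.ε⁻¹≈ε) (Dₙ.identityʳ g)

  -- Counting over Cay S through the right translation w ↦ w · u.
  countV-Cay-translate : ∀ (S : Dih n → Bool) (F : Dih n → Dih n → Bool) (u v : Dih n) →
    countV (Cay S) (λ w → F (w · (u ⁻¹)) (v · (w ⁻¹)))
      ≡ countV (Cay S) (λ w → F w ((v · (u ⁻¹)) · (w ⁻¹)))
  countV-Cay-translate S F u v = trans
    (sym (countV-∘-injective (Cay S) (λ w → F (w · (u ⁻¹)) (v · (w ⁻¹))) (Dₙ.∙-cancelʳ u _ _)))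
    (countFin-cong (λ i → cong₂ F (Dₙ.//-rightDividesʳ u (to i)) (regroup (to i))))
    where
      to = Inverse.to (Graph.enum (Cay S))
      regroup : ∀ w → v · ((w · u) ⁻¹) ≡ (v · (u ⁻¹)) · (w ⁻¹)
      regroup w = trans (cong (v ·_) (Dₙ.⁻¹-anti-homo-∙ w u)) (sym (Dₙ.assoc v (u ⁻¹) (w ⁻¹)))

  -- A partition of the group into {e}, two edge classes and the non-edges, with
  -- structure constants (a Schur ring of rank 4), inducing u, v ↦ class (v · u⁻¹).
  record DezaPartition (S : Dih n → Bool) : Set where
    field
      class                : Dih n → Fin 4
      class-eD             : class eD ≡ 0F
      class≡0F⇒≡eD         : ∀ {g} → class g ≡ 0F → g ≡ eD
      class-⁻¹             : ∀ g → class (g ⁻¹) ≡ class g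
      S-class              : ∀ g → S g ≡ isEdgeColour (class g)
      class-surjective     : ∀ i → ∃[ g ] class g ≡ i
      structure-constants  : ∀ g h → class g ≡ class h → ∀ i j →
        countV (Cay S) (λ w → eqFin (class w) i ∧ eqFin (class (g · (w ⁻¹))) j)
          ≡ countV (Cay S) (λ w → eqFin (class w) i ∧ eqFin (class (h · (w ⁻¹))) j)
      μ                    : Fin 4 → ℕ
      commonNbrs-class     : ∀ g → countV (Cay S) (λ w → S w ∧ S (g · (w ⁻¹))) ≡ μ (class g)
      μ₁≢μ₂                : μ 1F ≢ μ 2F
      μ₃≡μ₁⊎μ₃≡μ₂          : μ 3F ≡ μ 1F ⊎ μ 3F ≡ μ 2F
      μ₃≢0                 : μ 3F ≢ 0

    isConnectionSet : IsConnectionSet S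
    isConnectionSet =
      trans (S-class eD) (cong isEdgeColour class-eD) ,
      λ g → trans (S-class (g ⁻¹)) (trans (cong isEdgeColour (class-⁻¹ g)) (sym (S-class g)))

    dezaColouring : DezaColouring (Cay S)
    dezaColouring = record
      { colour               = λ u v → class (v · (u ⁻¹))
      ; colour-refl          = λ u → trans (cong class (Dₙ.inverseʳ u)) class-eD
      ; colour≡0F⇒≡          = λ {u} {v} → sym ∘ Dₙ.x∙y⁻¹≈ε⇒x≈y v u ∘ class≡0F⇒≡eD
      ; colour-sym           = λ u v →
                                 trans (cong class (sym (Dₙ.⁻¹-anti-homo-// v u))) (class-⁻¹ (v · (u ⁻¹)))
      ; adj-colour           = λ u v → S-class (v · (u ⁻¹))
      ; colour-surjective    = λ i → let (g , g≡i) = class-surjective i in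
                                 eD , g , trans (cong class (·eD⁻¹ g)) g≡i
      ; intersection-numbers = λ u v u′ v′ c≡ i j →
                                 let F = λ x y → eqFin (class x) i ∧ eqFin (class y) j in
                                 trans (translate F u v)
                                   (trans (structure-constants (v · (u ⁻¹)) (v′ · (u′ ⁻¹)) c≡ i j)
                                          (sym (translate F u′ v′)))
      ; μ                    = μ
      ; commonNbrs-colour    = λ u v →
                                 trans (translate (λ x y → S x ∧ S y) u v) (commonNbrs-class (v · (u ⁻¹)))
      ; μ₁≢μ₂                = μ₁≢μ₂
      ; μ₃≡μ₁⊎μ₃≡μ₂          = μ₃≡μ₁⊎μ₃≡μ₂
      ; μ₃≢0                 = μ₃≢0
      }
      where translate = countV-Cay-translate S

-- The graph Γ(D)

module _ {n : ℕ} {{_ : NonZero n}} where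
  countFin-translate : ∀ (t : Fin n) (P : Fin n → Bool) →
    countFin (λ j → P (t +ₙ j)) ≡ countFin P
  countFin-translate t P = countFin-∘-injective P (ℤₙ.∙-cancelˡ t _ _)

  countFin-reflect : ∀ (t : Fin n) (P : Fin n → Bool) →
    countFin (λ j → P (t +ₙ (-ₙ j))) ≡ countFin P
  countFin-reflect t P = countFin-∘-injective P (ℤₙ.⁻¹-injective ∘ ℤₙ.∙-cancelˡ t _ _)

  eqFin-−≡0ₙ : ∀ (a b : Fin n) → eqFin (a +ₙ (-ₙ b)) 0ₙ ≡ eqFin a b
  eqFin-−≡0ₙ a b = eqFin-⇔ (mk⇔ (ℤₙ.x∙y⁻¹≈ε⇒x≈y a b) ℤₙ.x≈y⇒x∙y⁻¹≈ε)

  eqFin-−+≡0ₙ : ∀ (t w : Fin n) → eqFin ((-ₙ t) +ₙ w) 0ₙ ≡ eqFin w t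
  eqFin-−+≡0ₙ t w = trans (cong (λ z → eqFin z 0ₙ) (+ₙ-comm (-ₙ t) w)) (eqFin-−≡0ₙ w t)

  −0ₙ : ∀ (t : Fin n) → t +ₙ (-ₙ 0ₙ) ≡ t
  −0ₙ t = trans (cong (t +ₙ_) ℤₙ.ε⁻¹≈ε) (ℤₙ.identityʳ t)

  -ₙ≢0ₙ : ∀ {t : Fin n} → t ≢ 0ₙ → -ₙ t ≢ 0ₙ
  -ₙ≢0ₙ {t} t≢0 -t≡0 = t≢0 (ℤₙ.⁻¹-injective (trans -t≡0 (sym ℤₙ.ε⁻¹≈ε)))

  reps≡countFin : ∀ (D : Fin n → Bool) h → reps D h ≡ countFin (λ d → D d ∧ D (h +ₙ d))
  reps≡countFin D h = trans (sumFin-cong row) (sym (countFin≡sumFin (λ d → D d ∧ D (h +ₙ d))))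
    where
      −≡⇔ : ∀ d₁ d₂ → (d₂ +ₙ (-ₙ d₁) ≡ h) ⇔ (d₂ ≡ h +ₙ d₁)
      −≡⇔ d₁ d₂ = mk⇔ (λ { refl → sym (ℤₙ.//-rightDividesˡ d₁ d₂) })
                      (λ { refl → ℤₙ.//-rightDividesʳ d₁ h })
      row : ∀ d₁ →
        countFin (λ d₂ → D d₁ ∧ D d₂ ∧ eqFin (d₂ +ₙ (-ₙ d₁)) h) ≡ χ (D d₁ ∧ D (h +ₙ d₁))
      row d₁ = trans
        (countFin-cong (λ d₂ → trans (sym (∧-assoc (D d₁) (D d₂) _))
          (trans (∧-comm (D d₁ ∧ D d₂) _)
                 (cong (_∧ (D d₁ ∧ D d₂)) (trans (eqFin-⇔ (−≡⇔ d₁ d₂)) (eqFin-sym d₂ _))))))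
        (countFin-singleton (h +ₙ d₁) (λ d₂ → D d₁ ∧ D d₂))

2*k+s+1≡2*n : ∀ {n s k} → 1 ≤ n → 2 * k + s ≡ 2 * n ∸ 1 → 2 * k + s + 1 ≡ 2 * n
2*k+s+1≡2*n {n} 1≤n h₁ = trans (cong (_+ 1) h₁) (m∸n+n≡m (≤-trans 1≤n (m≤m+n n (n + 0))))

differenceSet-k+k : ∀ {n s k λ′} → 3 ≤ n → 2 * k + s ≡ 2 * n ∸ 1 → λ′ + s ≡ n + 1 →
  (n ∸ 2) * 1 + λ′ ≡ k + k
differenceSet-k+k {suc (suc p)} {s} {k} {λ′} (s≤s (s≤s _)) h₁ h₂ = +-cancelʳ-≡ (s + 1) _ _ (begin
  p * 1 + λ′ + (s + 1)
    ≡⟨ solve 3 (λ p l s → p :* con 1 :+ l :+ (s :+ con 1) := p :+ (l :+ s) :+ con 1) refl p λ′ s ⟩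
  p + (λ′ + s) + 1
    ≡⟨ cong (λ z → p + z + 1) h₂ ⟩
  p + (2 + p + 1) + 1
    ≡⟨ solve 1 (λ p → p :+ (con 2 :+ p :+ con 1) :+ con 1 := con 2 :* (con 2 :+ p)) refl p ⟩
  2 * (2 + p)
    ≡⟨ 2*k+s+1≡2*n {2 + p} {s} {k} (s≤s z≤n) h₁ ⟨
  2 * k + s + 1
    ≡⟨ solve 2 (λ k s → con 2 :* k :+ s :+ con 1 := k :+ k :+ (s :+ con 1)) refl k s ⟩
  k + k + (s + 1) ∎)
  where open ≡-Reasoning

differenceSet-1≤k : ∀ {n s k λ′} → 3 ≤ n → 2 * k + s ≡ 2 * n ∸ 1 → λ′ + s ≡ n + 1 →
  1 ≤ k
differenceSet-1≤k {n} {s} {zero} {λ′} 3≤n h₁ h₂ =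
  ⊥-elim (<⇒≱ 3≤n (m+n≤o⇒n≤o λ′ (≤-reflexive λ′+n≡2)))
  where
    open ≡-Reasoning
    λ′+n≡2 : λ′ + n ≡ 2
    λ′+n≡2 = +-cancelʳ-≡ n _ _ (begin
      λ′ + n + n          ≡⟨ solve 2 (λ l n → l :+ n :+ n := l :+ con 2 :* n) refl λ′ n ⟩
      λ′ + 2 * n          ≡⟨ cong (λ′ +_) (2*k+s+1≡2*n {k = 0} (≤-trans (s≤s z≤n) 3≤n) h₁) ⟨
      λ′ + (s + 1)        ≡⟨ +-assoc λ′ s 1 ⟨
      λ′ + s + 1          ≡⟨ cong (_+ 1) h₂ ⟩
      n + 1 + 1           ≡⟨ solve 1 (λ n → n :+ con 1 :+ con 1 := con 2 :+ n) refl n ⟩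
      2 + n               ∎)
differenceSet-1≤k {k = suc k} _ _ _ = s≤s z≤n

differenceSet-k<n : ∀ {n s k} → 1 ≤ n → 2 * k + s ≡ 2 * n ∸ 1 → k < n
differenceSet-k<n {n} {s} {k} 1≤n h₁ = ≰⇒> λ n≤k → <-irrefl refl (begin-strict
  2 * n          ≤⟨ *-monoʳ-≤ 2 n≤k ⟩
  2 * k          ≤⟨ m≤m+n (2 * k) s ⟩
  2 * k + s      <⟨ m<m+n (2 * k + s) (s≤s z≤n) ⟩
  2 * k + s + 1  ≡⟨ 2*k+s+1≡2*n {s = s} {k} 1≤n h₁ ⟩
  2 * n          ∎)
  where open ≤-Reasoning

module DifferenceSetGraph {n : ℕ} {{_ : NonZero n}} (D : Fin n → Bool) where

  S : Dih n → Bool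
  S (a , i) = if eqFin a zero then not (eqFin i 0ₙ) else D i

  countV-Dih : ∀ (P : Dih n → Bool) →
    countV (Cay S) P ≡ countFin (λ j → P (0F , j)) + countFin (λ j → P (1F , j))
  countV-Dih P = begin
    countFin (P ∘ Inverse.to *↔×)
      ≡⟨ countFin≡sumFin (P ∘ Inverse.to *↔×) ⟩
    sumFin (χ ∘ P ∘ Inverse.to *↔×)
      ≡⟨ sumFin-*↔× 2 n (χ ∘ P) ⟩
    sumFin (λ j → χ (P (0F , j))) + (sumFin (λ j → χ (P (1F , j))) + 0)
      ≡⟨ cong₂ _+_ (countFin≡sumFin (λ j → P (0F , j)))
                   (trans (countFin≡sumFin (λ j → P (1F , j))) (sym (+-identityʳ _))) ⟨
    countFin (λ j → P (0F , j)) + countFin (λ j → P (1F , j)) ∎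
    where open ≡-Reasoning

  -- The classes {e}, A^#, yD and y(A ∖ D).
  classA : Bool → Fin 4
  classA b = if b then 0F else 1F

  classB : Bool → Fin 4
  classB b = if b then 2F else 3F

  class : Dih n → Fin 4
  class (0F , j) = classA (eqFin j 0ₙ)
  class (1F , j) = classB (D j)

  classA-injective : ∀ {a b} → classA a ≡ classA b → a ≡ b
  classA-injective {true}  {true}  _ = refl
  classA-injective {false} {false} _ = refl

  classB-injective : ∀ {a b} → classB a ≡ classB b → a ≡ b
  classB-injective {true}  {true}  _ = refl
  classB-injective {false} {false} _ = refl

  classA≢classB : ∀ a b → classA a ≢ classB b
  classA≢classB true  true  ()
  classA≢classB true  false ()
  classA≢classB false true  ()
  classA≢classB false false ()

  class≡0F⇒≡eD : ∀ g → class g ≡ 0F → g ≡ eD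
  class≡0F⇒≡eD (0F , t) e = cong (0F ,_) (eqFin-true (classA-injective {b = true} e))
  class≡0F⇒≡eD (1F , t) e = ⊥-elim (classA≢classB true (D t) (sym e))

  class-⁻¹ : ∀ g → class (g ⁻¹) ≡ class g
  class-⁻¹ (0F , t) = cong classA (eqFin-⇔ (mk⇔
    (λ -t≡0 → ℤₙ.⁻¹-injective (trans -t≡0 (sym ℤₙ.ε⁻¹≈ε)))
    (λ t≡0 → trans (cong -ₙ_ t≡0) ℤₙ.ε⁻¹≈ε)))
  class-⁻¹ (1F , t) = refl

  S-class : ∀ g → S g ≡ isEdgeColour (class g)
  S-class (0F , t) with eqFin t 0ₙ
  ... | true  = refl
  ... | false = refl
  S-class (1F , t) with D t
  ... | true  = refl
  ... | false = refl

  commonNbrsₑ : Dih n → ℕ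
  commonNbrsₑ g = countV (Cay S) (λ w → S w ∧ S (g · (w ⁻¹)))

  interPredₑ : Dih n → Fin 4 → Fin 4 → Dih n → Bool
  interPredₑ g i j w = eqFin (class w) i ∧ eqFin (class (g · (w ⁻¹))) j

  interNumₑ : Dih n → Fin 4 → Fin 4 → ℕ
  interNumₑ g i j = countV (Cay S) (interPredₑ g i j)

  interNumₑ-rows : ∀ g g′ i j →
    countFin (λ w → interPredₑ g i j (0F , w)) ≡ countFin (λ w → interPredₑ g′ i j (0F , w)) →
    countFin (λ w → interPredₑ g i j (1F , w)) ≡ countFin (λ w → interPredₑ g′ i j (1F , w)) →
    interNumₑ g i j ≡ interNumₑ g′ i j
  interNumₑ-rows g g′ i j row₀ row₁ =
    trans (countV-Dih (interPredₑ g i j))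
          (trans (cong₂ _+_ row₀ row₁) (sym (countV-Dih (interPredₑ g′ i j))))

  row-cong : ∀ (P Q Q′ : Fin n → Bool) → countFin Q ≡ countFin Q′ →
    countFin (λ w → P w ∧ Q w) ≡ countFin (λ w → P w ∧ Q′ w) →
    ∀ F → countFin (λ w → F (P w) (Q w)) ≡ countFin (λ w → F (P w) (Q′ w))
  row-cong P Q Q′ #Q #PQ = countFin-cells-cong P Q P Q′ refl #Q #PQ

  module Parameters (k λ′ : ℕ) (#D : countFin D ≡ k)
                    (reps≡λ′ : ∀ h → h ≢ 0ₙ → reps D h ≡ λ′) where

    D∩shifted : ∀ t → t ≢ 0ₙ → countFin (λ w → D w ∧ D ((-ₙ t) +ₙ w)) ≡ λ′
    D∩shifted t t≢0 = trans (sym (reps≡countFin D (-ₙ t))) (reps≡λ′ (-ₙ t) (-ₙ≢0ₙ t≢0))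

    interNumₑ-A : ∀ t t′ → eqFin t 0ₙ ≡ eqFin t′ 0ₙ →
      ∀ i j → interNumₑ (0F , t) i j ≡ interNumₑ (0F , t′) i j
    interNumₑ-A t t′ e  i j with t ≟ 0ₙ | t′ ≟ 0ₙ
    interNumₑ-A t t′ e  i j | yes refl | yes refl = refl
    interNumₑ-A t t′ () i j | yes _    | no _
    interNumₑ-A t t′ () i j | no _     | yes _
    interNumₑ-A t t′ e  i j | no t≢0   | no t′≢0  = interNumₑ-rows (0F , t) (0F , t′) i j
      (row-cong (λ w → eqFin w 0ₙ) (Q t) (Q t′)
                (trans (#Q t) (sym (#Q t′)))
                (trans (#PQ t t≢0) (sym (#PQ t′ t′≢0)))
                (λ p q → eqFin (classA p) i ∧ eqFin (classA q) j))
      (row-cong D (λ w → D ((-ₙ t) +ₙ w)) (λ w → D ((-ₙ t′) +ₙ w))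
                (trans (countFin-translate (-ₙ t) D) (sym (countFin-translate (-ₙ t′) D)))
                (trans (D∩shifted t t≢0) (sym (D∩shifted t′ t′≢0)))
                (λ p q → eqFin (classB p) i ∧ eqFin (classB q) j))
      where
        Q : Fin n → Fin n → Bool
        Q s w = eqFin (s +ₙ (-ₙ w)) 0ₙ
        #Q : ∀ s → countFin (Q s) ≡ countFin (λ w → eqFin w 0ₙ)
        #Q s = countFin-reflect s (λ x → eqFin x 0ₙ)
        #PQ : ∀ s → s ≢ 0ₙ → countFin (λ w → eqFin w 0ₙ ∧ Q s w) ≡ 0
        #PQ s s≢0 =
          trans (countFin-singletonˡ 0ₙ (Q s)) (cong χ (trans (eqFin-−≡0ₙ s 0ₙ) (eqFin-≢ s≢0)))

    interNumₑ-B : ∀ t t′ → D t ≡ D t′ →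
      ∀ i j → interNumₑ (1F , t) i j ≡ interNumₑ (1F , t′) i j
    interNumₑ-B t t′ Dt≡Dt′ i j = interNumₑ-rows (1F , t) (1F , t′) i j
      (row-cong (λ w → eqFin w 0ₙ) (λ w → D (t +ₙ (-ₙ w))) (λ w → D (t′ +ₙ (-ₙ w)))
                (trans (countFin-reflect t D) (sym (countFin-reflect t′ D)))
                (trans (at0 t) (trans (cong χ Dt≡Dt′) (sym (at0 t′))))
                (λ p q → eqFin (classA p) i ∧ eqFin (classB q) j))
      (row-cong D (Q t) (Q t′)
                (trans (#Q t) (sym (#Q t′)))
                (trans (atD t) (trans (cong χ Dt≡Dt′) (sym (atD t′))))
                (λ p q → eqFin (classB p) i ∧ eqFin (classA q) j))
      where
        Q : Fin n → Fin n → Bool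
        Q s w = eqFin ((-ₙ s) +ₙ w) 0ₙ
        #Q : ∀ s → countFin (Q s) ≡ countFin (λ w → eqFin w 0ₙ)
        #Q s = countFin-translate (-ₙ s) (λ x → eqFin x 0ₙ)
        at0 : ∀ s → countFin (λ w → eqFin w 0ₙ ∧ D (s +ₙ (-ₙ w))) ≡ χ (D s)
        at0 s = trans (countFin-singletonˡ 0ₙ (λ w → D (s +ₙ (-ₙ w)))) (cong (χ ∘ D) (−0ₙ s))
        atD : ∀ s → countFin (λ w → D w ∧ Q s w) ≡ χ (D s)
        atD s = trans (countFin-cong (λ w → cong (D w ∧_) (eqFin-−+≡0ₙ s w)))
                      (countFin-singletonʳ s D)

    structure-constants : ∀ g h → class g ≡ class h → ∀ i j → interNumₑ g i j ≡ interNumₑ h i j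
    structure-constants (0F , t) (0F , t′) e = interNumₑ-A t t′ (classA-injective e)
    structure-constants (1F , t) (1F , t′) e = interNumₑ-B t t′ (classB-injective e)
    structure-constants (0F , t) (1F , t′) e = ⊥-elim (classA≢classB _ _ e)
    structure-constants (1F , t) (0F , t′) e = ⊥-elim (classA≢classB _ _ (sym e))

    commonNbrsₑ-A : ∀ t → t ≢ 0ₙ → commonNbrsₑ (0F , t) ≡ (n ∸ 2) * 1 + λ′
    commonNbrsₑ-A t t≢0 =
      trans (countV-Dih (λ w → S w ∧ S ((0F , t) · (w ⁻¹)))) (cong₂ _+_ row₀ (D∩shifted t t≢0))
      where
        row₀ : countFin (λ w → not (eqFin w 0ₙ) ∧ not (eqFin (t +ₙ (-ₙ w)) 0ₙ)) ≡ (n ∸ 2) * 1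
        row₀ = trans
          (countFin-cong (λ w → cong₂ (λ x y → not x ∧ not y) (eqFin-sym w 0ₙ)
                                      (trans (eqFin-−≡0ₙ t w) (eqFin-sym t w))))
          (trans (countFin-twoPoint 0ₙ t (λ x y → not x ∧ not y))
                 (cong (twoPointSum n (λ x y → χ (not x ∧ not y))) (eqFin-≢ (t≢0 ∘ sym))))

    commonNbrsₑ-B : ∀ t → commonNbrsₑ (1F , t) + χ (D t) + χ (D t) ≡ k + k
    commonNbrsₑ-B t = begin
      commonNbrsₑ (1F , t) + χ (D t) + χ (D t)
        ≡⟨ cong (λ z → z + χ (D t) + χ (D t)) (countV-Dih (λ w → S w ∧ S ((1F , t) · (w ⁻¹)))) ⟩
      row₀ + row₁ + χ (D t) + χ (D t)
        ≡⟨ solve 3 (λ a b c → a :+ b :+ c :+ c := (a :+ c) :+ (b :+ c)) refl row₀ row₁ (χ (D t)) ⟩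
      (row₀ + χ (D t)) + (row₁ + χ (D t))
        ≡⟨ cong₂ _+_ row₀+χ≡k row₁+χ≡k ⟩
      k + k ∎
      where
        open ≡-Reasoning
        Dₜ = λ w → D (t +ₙ (-ₙ w))
        row₀ = countFin (λ w → not (eqFin w 0ₙ) ∧ Dₜ w)
        row₁ = countFin (λ w → D w ∧ not (eqFin ((-ₙ t) +ₙ w) 0ₙ))
        row₀+χ≡k : row₀ + χ (D t) ≡ k
        row₀+χ≡k = begin
          row₀ + χ (D t)
            ≡⟨ cong₂ _+_ (countFin-cong (λ w → ∧-comm (Dₜ w) (not (eqFin w 0ₙ))))
                         (cong (χ ∘ D) (−0ₙ t)) ⟨
          countFin (λ w → Dₜ w ∧ not (eqFin w 0ₙ)) + χ (Dₜ 0ₙ)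
            ≡⟨ +-comm (countFin (λ w → Dₜ w ∧ not (eqFin w 0ₙ))) (χ (Dₜ 0ₙ)) ⟩
          χ (Dₜ 0ₙ) + countFin (λ w → Dₜ w ∧ not (eqFin w 0ₙ))
            ≡⟨ cong (_+ countFin (λ w → Dₜ w ∧ not (eqFin w 0ₙ))) (countFin-singletonʳ 0ₙ Dₜ) ⟨
          countFin (λ w → Dₜ w ∧ eqFin w 0ₙ) + countFin (λ w → Dₜ w ∧ not (eqFin w 0ₙ))
            ≡⟨ countFin-partition Dₜ (λ w → eqFin w 0ₙ) ⟩
          countFin Dₜ
            ≡⟨ trans (countFin-reflect t D) #D ⟩
          k ∎
        row₁+χ≡k : row₁ + χ (D t) ≡ k
        row₁+χ≡k = begin
          row₁ + χ (D t)
            ≡⟨ cong₂ _+_ (countFin-cong (λ w → cong (λ b → D w ∧ not b) (eqFin-−+≡0ₙ t w)))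
                         (sym (countFin-singletonʳ t D)) ⟩
          countFin (λ w → D w ∧ not (eqFin w t)) + countFin (λ w → D w ∧ eqFin w t)
            ≡⟨ +-comm (countFin (λ w → D w ∧ not (eqFin w t))) (countFin (λ w → D w ∧ eqFin w t)) ⟩
          countFin (λ w → D w ∧ eqFin w t) + countFin (λ w → D w ∧ not (eqFin w t))
            ≡⟨ countFin-partition D (λ w → eqFin w t) ⟩
          countFin D
            ≡⟨ #D ⟩
          k ∎

    μ : Fin 4 → ℕ
    μ 0F = commonNbrsₑ eD
    μ 1F = k + k
    μ 2F = k + k ∸ 2
    μ 3F = k + k

    commonNbrs-class : (n ∸ 2) * 1 + λ′ ≡ k + k → ∀ g → commonNbrsₑ g ≡ μ (class g)
    commonNbrs-class n∸2+λ′≡k+k (0F , t) with t ≟ 0ₙ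
    ... | yes refl = refl
    ... | no t≢0   = trans (commonNbrsₑ-A t t≢0) n∸2+λ′≡k+k
    commonNbrs-class _ (1F , t) with D t | commonNbrsₑ-B t
    ... | true  | c+2≡k+k = sym (trans (cong (_∸ 2) (sym c+2≡k+k))
                                  (trans (cong (_∸ 2) (+-assoc (commonNbrsₑ (1F , t)) 1 1))
                                         (m+n∸n≡m (commonNbrsₑ (1F , t)) 2)))
    ... | false | c+0≡k+k = trans (sym (trans (+-identityʳ _) (+-identityʳ _))) c+0≡k+k

    dezaPartition : 2 ≤ n → (n ∸ 2) * 1 + λ′ ≡ k + k → 1 ≤ k → k < n → DezaPartition S
    dezaPartition 2≤n n∸2+λ′≡k+k 1≤k k<n = record
      { class               = class
      ; class-eD            = cong classA (eqFin-refl 0ₙ)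
      ; class≡0F⇒≡eD        = λ {g} → class≡0F⇒≡eD g
      ; class-⁻¹            = class-⁻¹
      ; S-class             = S-class
      ; class-surjective    = class-surjective
      ; structure-constants = structure-constants
      ; μ                   = μ
      ; commonNbrs-class    = commonNbrs-class n∸2+λ′≡k+k
      ; μ₁≢μ₂               = m+1+n≢m (k + k ∸ 2) ∘ trans (m∸n+n≡m 2≤k+k)
      ; μ₃≡μ₁⊎μ₃≡μ₂         = inj₁ refl
      ; μ₃≢0                = λ k+k≡0 → <⇒≢ 1≤k (sym (m+n≡0⇒m≡0 k k+k≡0))
      }
      where
        2≤k+k : 2 ≤ k + k
        2≤k+k = +-mono-≤ 1≤k 1≤k
        1ₙ≢0ₙ : 1 mod n ≢ 0ₙ
        1ₙ≢0ₙ e =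
          1+n≢0 (trans (sym (trans (toℕ-mod 1) (m<n⇒m%n≡m 2≤n))) (trans (cong toℕ e) toℕ-0ₙ))
        d∈D : ∃[ d ] D d ≡ true
        d∈D = countFin-witness D (λ #D≡0 → <⇒≢ 1≤k (sym (trans (sym #D) #D≡0)))
        d∉D : ∃[ d ] not (D d) ≡ true
        d∉D = countFin-witness (not ∘ D) (λ #¬D≡0 → <⇒≢ k<n (trans (sym (+-identityʳ k))
                (trans (cong₂ _+_ (sym #D) (sym #¬D≡0)) (countFin-complement D))))
        class-surjective : ∀ i → ∃[ g ] class g ≡ i
        class-surjective 0F = eD , cong classA (eqFin-refl 0ₙ)
        class-surjective 1F = (0F , 1 mod n) , cong classA (eqFin-≢ 1ₙ≢0ₙ)
        class-surjective 2F = let (d , Dd) = d∈D in (1F , d) , cong classB Dd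
        class-surjective 3F = let (d , ¬Dd) = d∉D in
          (1F , d) , cong classB (not-injective ¬Dd)

ΓD-isStrictlyDezaDihedrantWLRank4 : ∀ (n : ℕ) {{_ : NonZero n}} → 3 ≤ n →
  ∀ (D : Fin n → Bool) (s k λ′ : ℕ) →
  s * s ≡ 8 * n ∸ 7 → 2 * k + s ≡ 2 * n ∸ 1 → λ′ + s ≡ n + 1 →
  IsDifferenceSet D n k λ′ →
  IsStrictlyDezaDihedrantWLRank4 (ΓD D)
ΓD-isStrictlyDezaDihedrantWLRank4 n 3≤n D s k λ′ _ h₁ h₂ (_ , #D , _ , reps≡λ′) =
  isDihedrant-Cay 3≤n (DezaPartition.isConnectionSet P) ,
  isStrictlyDeza×hasWLRank4 (DezaPartition.dezaColouring P)
  where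
    open DifferenceSetGraph D
    1≤n = ≤-trans (s≤s z≤n) 3≤n
    P = Parameters.dezaPartition k λ′ #D reps≡λ′ (≤-trans (n≤1+n 2) 3≤n)
          (differenceSet-k+k {s = s} {k} 3≤n h₁ h₂) (differenceSet-1≤k {s = s} {k} 3≤n h₁ h₂)
          (differenceSet-k<n {s = s} 1≤n h₁)

-- K_4 × K_m as a Cayley graph over a dihedral group

injective⇒rightInverse : ∀ {A B : Set} {N} → Fin N ↔ A → Fin N ↔ B →
  (f : A → B) → Injective _≡_ _≡_ f → ∃[ g ] (∀ b → f (g b) ≡ b)
injective⇒rightInverse {A} {B} {N} enumA enumB f f-inj = g , f∘g
  where
    toA = Inverse.to enumA
    toB = Inverse.to enumB
    fromB = Inverse.from enumB
    h : Fin N → Fin N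
    h = fromB ∘ f ∘ toA
    h-inj : Injective _≡_ _≡_ h
    h-inj = Injection.injective (↔⇒↣ enumA) ∘ f-inj ∘ Injection.injective (↔⇒↣ (↔-sym enumB))
    preimage : ∀ y → ∃[ i ] eqFin (h i) y ≡ true
    preimage y = countFin-witness (λ i → eqFin (h i) y) (λ #≡0 → 1+n≢0 (trans (sym #fibre) #≡0))
      where
        #fibre : countFin (λ i → eqFin (h i) y) ≡ 1
        #fibre = trans (countFin-∘-injective (λ j → eqFin j y) h-inj)
          (trans (countFin-cong (λ j → sym (∧-identityʳ (eqFin j y)))) (countFin-singletonˡ y (λ _ → true)))
    g : B → A
    g b = toA (proj₁ (preimage (fromB b)))
    f∘g : ∀ b → f (g b) ≡ b
    f∘g b = trans (sym (Inverse.strictlyInverseˡ enumB _))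
      (trans (cong toB (eqFin-true (proj₂ (preimage (fromB b))))) (Inverse.strictlyInverseˡ enumB b))

module _ {M : ℕ} {{nz : NonZero M}} where
  -- The fibres of α are the right cosets of the subgroup α⁻¹ (α e).
  RightCosetLabelling : ∀ {r} → (Dih M → Fin r) → Set
  RightCosetLabelling α = ∀ g h → eqFin (α g) (α h) ≡ eqFin (α (h · (g ⁻¹))) (α eD)

  reflection-labelling : RightCosetLabelling proj₁
  reflection-labelling (0F , i) (0F , j) = refl
  reflection-labelling (0F , i) (1F , j) = refl
  reflection-labelling (1F , i) (0F , j) = refl
  reflection-labelling (1F , i) (1F , j) = refl

  eqFin-combine : ∀ {a b} (x x′ : Fin a) (y y′ : Fin b) →
    eqFin (combine x y) (combine x′ y′) ≡ eqFin x x′ ∧ eqFin y y′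
  eqFin-combine x x′ y y′ with x ≟ x′ | y ≟ y′
  ... | yes refl | yes refl = eqFin-refl (combine x y)
  ... | yes refl | no y≢y′  = eqFin-≢ (y≢y′ ∘ proj₂ ∘ Finₚ.combine-injective x y x′ y′)
  ... | no x≢x′  | _        = eqFin-≢ (x≢x′ ∘ proj₁ ∘ Finₚ.combine-injective x y x′ y′)

  combine-labelling : ∀ {a b} {α : Dih M → Fin a} {β : Dih M → Fin b} →
    RightCosetLabelling α → RightCosetLabelling β → RightCosetLabelling (λ g → combine (α g) (β g))
  combine-labelling {α = α} {β} α-coset β-coset g h = begin
    eqFin (combine (α g) (β g)) (combine (α h) (β h))
      ≡⟨ eqFin-combine (α g) (α h) (β g) (β h) ⟩
    eqFin (α g) (α h) ∧ eqFin (β g) (β h)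
      ≡⟨ cong₂ _∧_ (α-coset g h) (β-coset g h) ⟩
    eqFin (α hg⁻¹) (α eD) ∧ eqFin (β hg⁻¹) (β eD)
      ≡⟨ eqFin-combine (α hg⁻¹) (α eD) (β hg⁻¹) (β eD) ⟨
    eqFin (combine (α hg⁻¹) (β hg⁻¹)) (combine (α eD) (β eD)) ∎
    where
      open ≡-Reasoning
      hg⁻¹ = h · (g ⁻¹)

  KK-isDihedrant : 3 ≤ M → ∀ {a b} (α : Dih M → Fin a) (β : Dih M → Fin b) →
    RightCosetLabelling α → RightCosetLabelling β →
    (∀ {g h} → α g ≡ α h → β g ≡ β h → g ≡ h) → 2 * M ≡ a * b →
    IsDihedrant (KK a b)
  KK-isDihedrant 3≤M {a} {b} α β α-coset β-coset αβ-injective 2M≡ab =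
    M , nz , 3≤M , S , (S-eD , S-⁻¹) , mk↔ₛ′ σ ρ σρ ρσ , adj-σ
    where
      S : Dih M → Bool
      S g = rook (eqFin (α g) (α eD)) (eqFin (β g) (β eD))
      S-eD : S eD ≡ false
      S-eD = cong₂ rook (eqFin-refl (α eD)) (eqFin-refl (β eD))
      ⁻¹-coset : ∀ {r} (γ : Dih M → Fin r) → RightCosetLabelling γ →
        ∀ g → eqFin (γ (g ⁻¹)) (γ eD) ≡ eqFin (γ g) (γ eD)
      ⁻¹-coset γ γ-coset g =
        sym (trans (γ-coset g eD) (cong (λ x → eqFin (γ x) (γ eD)) (Dₙ.identityˡ (g ⁻¹))))
      S-⁻¹ : ∀ g → S (g ⁻¹) ≡ S g
      S-⁻¹ g = cong₂ rook (⁻¹-coset α α-coset g) (⁻¹-coset β β-coset g)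
      ρ : Dih M → Fin a × Fin b
      ρ g = α g , β g
      ρ-injective : Injective _≡_ _≡_ ρ
      ρ-injective e = αβ-injective (cong proj₁ e) (cong proj₂ e)
      enumKK : Fin (2 * M) ↔ (Fin a × Fin b)
      enumKK = subst (λ N → Fin N ↔ (Fin a × Fin b)) (sym 2M≡ab) *↔×
      σ : Fin a × Fin b → Dih M
      σ = proj₁ (injective⇒rightInverse *↔× enumKK ρ ρ-injective)
      ρσ : ∀ u → ρ (σ u) ≡ u
      ρσ = proj₂ (injective⇒rightInverse *↔× enumKK ρ ρ-injective)
      σρ : ∀ g → σ (ρ g) ≡ g
      σρ g = ρ-injective (ρσ (ρ g))
      adj-ρ : ∀ g h → Graph.adj (KK a b) (ρ g) (ρ h) ≡ Graph.adj (Cay S) g h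
      adj-ρ g h = cong₂ rook (α-coset g h) (β-coset g h)
      adj-σ : ∀ u v → Graph.adj (KK a b) u v ≡ Graph.adj (Cay S) (σ u) (σ v)
      adj-σ u v = trans (sym (cong₂ (Graph.adj (KK a b)) (ρσ u) (ρσ v))) (adj-ρ (σ u) (σ v))

residue : ∀ {M} d {{_ : NonZero d}} → Fin M → Fin d
residue d i = toℕ i mod d

module _ {M : ℕ} {{_ : NonZero M}} {d : ℕ} {{_ : NonZero d}} (d∣M : d ∣ M) where
  residue-0ₙ : residue d (0ₙ {M}) ≡ 0ₙ
  residue-0ₙ = Finₚ.toℕ-injective (trans (toℕ-mod (toℕ (0ₙ {M})))
    (trans (cong (_% d) toℕ-0ₙ) (trans (m<n⇒m%n≡m (>-nonZero⁻¹ d)) (sym toℕ-0ₙ))))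

  residue-+ₙ : ∀ (i j : Fin M) → residue d (i +ₙ j) ≡ residue d i +ₙ residue d j
  residue-+ₙ i j = Finₚ.toℕ-injective (begin
    toℕ (residue d (i +ₙ j))                  ≡⟨ toℕ-mod (toℕ (i +ₙ j)) ⟩
    toℕ (i +ₙ j) % d                          ≡⟨ cong (_% d) (toℕ-+ₙ i j) ⟩
    (toℕ i + toℕ j) % M % d                   ≡⟨ m∣n⇒o%n%m≡o%m d M (toℕ i + toℕ j) d∣M ⟩
    (toℕ i + toℕ j) % d                       ≡⟨ %-distribˡ-+ (toℕ i) (toℕ j) d ⟩
    (toℕ i % d + toℕ j % d) % d
      ≡⟨ cong₂ (λ x y → (x + y) % d) (toℕ-mod (toℕ i)) (toℕ-mod (toℕ j)) ⟨
    (toℕ (residue d i) + toℕ (residue d j)) % d ≡⟨ toℕ-+ₙ (residue d i) (residue d j) ⟨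
    toℕ (residue d i +ₙ residue d j)          ∎)
    where open ≡-Reasoning

  residue-−≡0ₙ⇔ : ∀ (i j : Fin M) →
    (residue d (j +ₙ (-ₙ i)) ≡ residue d 0ₙ) ⇔ (residue d i ≡ residue d j)
  residue-−≡0ₙ⇔ i j = mk⇔
    (λ e → sym (ℤₙ.x∙y⁻¹≈ε⇒x≈y _ _ (trans (sym residue-−) (trans e residue-0ₙ))))
    (λ e → trans residue-− (trans (ℤₙ.x≈y⇒x∙y⁻¹≈ε (sym e)) (sym residue-0ₙ)))
    where
      residue-⁻¹ : residue d (-ₙ i) ≡ -ₙ residue d i
      residue-⁻¹ = ℤₙ.inverseʳ-unique (residue d i) (residue d (-ₙ i))
        (trans (sym (residue-+ₙ i (-ₙ i))) (trans (cong (residue d) (+ₙ-inverseʳ i)) residue-0ₙ))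
      residue-− : residue d (j +ₙ (-ₙ i)) ≡ residue d j +ₙ (-ₙ residue d i)
      residue-− = trans (residue-+ₙ j (-ₙ i)) (cong (residue d j +ₙ_) residue-⁻¹)

  residue-labelling : RightCosetLabelling (residue d ∘ proj₂)
  residue-labelling (0F , i) (b , j) = sym (eqFin-⇔ (residue-−≡0ₙ⇔ i j))
  residue-labelling (1F , i) (b , j) = sym (eqFin-⇔ (mk⇔
    (λ e → sym (Equivalence.to (residue-−≡0ₙ⇔ j i) (trans (cong (residue d) (+ₙ-comm i (-ₙ j))) e)))
    (λ e → trans (cong (residue d) (+ₙ-comm (-ₙ j) i)) (Equivalence.from (residue-−≡0ₙ⇔ j i) (sym e)))))

  residue≡0ₙ⇒∣ : ∀ (i : Fin M) → residue d i ≡ 0ₙ → d ∣ toℕ i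
  residue≡0ₙ⇒∣ i e =
    m%n≡0⇒n∣m (toℕ i) d (trans (sym (toℕ-mod (toℕ i))) (trans (cong toℕ e) toℕ-0ₙ))

coprime-*-∣ : ∀ {c e x} → Coprime c e → c ∣ x → e ∣ x → c * e ∣ x
coprime-*-∣ {c} {e} c⊥e c∣x (divides q refl) =
  *-monoˡ-∣ e (coprime-divisor c⊥e (subst (c ∣_) (*-comm q e) c∣x))

coprime-*ˡ : ∀ {a b c} → Coprime a c → Coprime b c → Coprime (a * b) c
coprime-*ˡ {a} a⊥c b⊥c (d∣ab , d∣c) =
  b⊥c (coprime-divisor (λ (i∣d , i∣a) → a⊥c (i∣a , ∣-trans i∣d d∣c)) d∣ab , d∣c)

¬2∣⇒coprime : ∀ {m} → ¬ 2 ∣ m → Coprime 2 m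
¬2∣⇒coprime 2∤m {0} (0∣2 , _) with 0∣⇒≡0 0∣2
... | ()
¬2∣⇒coprime 2∤m {1} _ = refl
¬2∣⇒coprime 2∤m {2} (_ , 2∣m) = ⊥-elim (2∤m 2∣m)
¬2∣⇒coprime 2∤m {suc (suc (suc d))} (d∣2 , _) with ∣⇒≤ d∣2
... | s≤s (s≤s ())

∣∧<⇒≡0 : ∀ {m x} → m ∣ x → x < m → x ≡ 0
∣∧<⇒≡0 {x = zero}  _   _   = refl
∣∧<⇒≡0 {x = suc x} m∣x x<m = ⊥-elim (<⇒≱ x<m (∣⇒≤ m∣x))

residues-injective : ∀ {c e M} {{_ : NonZero c}} {{_ : NonZero e}} {{_ : NonZero M}} →
  Coprime c e → c * e ≡ M →
  ∀ {i j : Fin M} → residue c i ≡ residue c j → residue e i ≡ residue e j → i ≡ j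
residues-injective {c} {e} {M} c⊥e ce≡M {i} {j} cᵢ≡cⱼ eᵢ≡eⱼ =
  sym (ℤₙ.x∙y⁻¹≈ε⇒x≈y j i (Finₚ.toℕ-injective (trans toℕx≡0 (sym toℕ-0ₙ))))
  where
    x = j +ₙ (-ₙ i)
    c∣M : c ∣ M
    c∣M = divides e (trans (sym ce≡M) (*-comm c e))
    e∣M : e ∣ M
    e∣M = divides c (sym ce≡M)
    residue-x≡0ₙ : ∀ {d} {{_ : NonZero d}} (d∣M : d ∣ M) →
      residue d i ≡ residue d j → residue d x ≡ 0ₙ
    residue-x≡0ₙ d∣M e = trans (Equivalence.from (residue-−≡0ₙ⇔ d∣M i j) e) (residue-0ₙ d∣M)
    toℕx≡0 : toℕ x ≡ 0
    toℕx≡0 = ∣∧<⇒≡0 (coprime-*-∣ c⊥e (residue≡0ₙ⇒∣ c∣M x (residue-x≡0ₙ c∣M cᵢ≡cⱼ))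
                                      (residue≡0ₙ⇒∣ e∣M x (residue-x≡0ₙ e∣M eᵢ≡eⱼ)))
                    (subst (toℕ x <_) (sym ce≡M) (Finₚ.toℕ<n x))

-- For odd m, y^a x^i ↦ ((a , i mod 2) , i mod m) identifies the dihedral group of order 4m
-- with K_4 × K_m.
KK4-isDihedrant-odd : ∀ m → 2 ≤ m → ¬ 2 ∣ m → IsDihedrant (KK 4 m)
KK4-isDihedrant-odd (suc m′) 2≤m 2∤m =
  KK-isDihedrant 3≤M α β
    (combine-labelling reflection-labelling (residue-labelling 2∣M)) (residue-labelling m∣M)
    injective (sym (*-assoc 2 2 m))
  where
    m = suc m′
    M = 2 * m
    3≤M : 3 ≤ M
    3≤M = ≤-trans (s≤s (s≤s (s≤s z≤n))) (*-monoʳ-≤ 2 2≤m)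
    2∣M : 2 ∣ M
    2∣M = divides m (*-comm 2 m)
    m∣M : m ∣ M
    m∣M = divides 2 refl
    α : Dih M → Fin 4
    α (a , i) = combine a (residue 2 i)
    β : Dih M → Fin m
    β (a , i) = residue m i
    injective : ∀ {g h} → α g ≡ α h → β g ≡ β h → g ≡ h
    injective {a , i} {b , j} αg≡αh βg≡βh =
      let (a≡b , 2ᵢ≡2ⱼ) = Finₚ.combine-injective a (residue 2 i) b (residue 2 j) αg≡αh in
      cong₂ _,_ a≡b (residues-injective (¬2∣⇒coprime 2∤m) refl 2ᵢ≡2ⱼ βg≡βh)

-- For m = 2r with r odd, y^a x^i ↦ (i mod 4 , (i mod r , a)) identifies the dihedral group
-- of order 4m with K_4 × K_m.
KK4-isDihedrant-twiceOdd : ∀ r → ¬ 2 ∣ r → IsDihedrant (KK 4 (r * 2))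
KK4-isDihedrant-twiceOdd 0 2∤r = ⊥-elim (2∤r (divides 0 refl))
KK4-isDihedrant-twiceOdd (suc r′) 2∤r =
  KK-isDihedrant 3≤M α β
    (residue-labelling 4∣M) (combine-labelling (residue-labelling r∣M) reflection-labelling)
    injective (sym (*-assoc 2 2 m))
  where
    r = suc r′
    m = r * 2
    M = 2 * m
    4r≡M : 4 * r ≡ M
    4r≡M = solve 1 (λ r → con 4 :* r := con 2 :* (r :* con 2)) refl r
    3≤M : 3 ≤ M
    3≤M = subst (3 ≤_) 4r≡M (≤-trans (n≤1+n 3) (*-monoʳ-≤ 4 (s≤s (z≤n {r′}))))
    4∣M : 4 ∣ M
    4∣M = divides r (trans (sym 4r≡M) (*-comm 4 r))
    r∣M : r ∣ M
    r∣M = divides 4 (sym 4r≡M)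
    α : Dih M → Fin 4
    α (a , i) = residue 4 i
    β : Dih M → Fin m
    β (a , i) = combine (residue r i) a
    injective : ∀ {g h} → α g ≡ α h → β g ≡ β h → g ≡ h
    injective {a , i} {b , j} αg≡αh βg≡βh =
      let (rᵢ≡rⱼ , a≡b) = Finₚ.combine-injective (residue r i) a (residue r j) b βg≡βh in
      cong₂ _,_ a≡b (residues-injective (coprime-*ˡ 2⊥r 2⊥r) 4r≡M αg≡αh rᵢ≡rⱼ)
      where 2⊥r = ¬2∣⇒coprime 2∤r

KK4-isDihedrant : ∀ m → 2 ≤ m → ¬ 4 ∣ m → IsDihedrant (KK 4 m)
KK4-isDihedrant m 2≤m 4∤m with 2 ∣? m
... | no 2∤m               = KK4-isDihedrant-odd m 2≤m 2∤m
... | yes (divides r refl) = KK4-isDihedrant-twiceOdd r (4∤m ∘ *-monoˡ-∣ 2)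

KK4-isStrictlyDezaDihedrantWLRank4 : ∀ (m : ℕ) → 2 ≤ m → ¬ (4 ∣ m) →
  IsStrictlyDezaDihedrantWLRank4 (KK 4 m)
KK4-isStrictlyDezaDihedrantWLRank4 m 2≤m 4∤m =
  KK4-isDihedrant m 2≤m 4∤m ,
  isStrictlyDeza×hasWLRank4 (rookColouring m 2≤m (λ m≡4 → 4∤m (subst (4 ∣_) (sym m≡4) ∣-refl)))

theorem1p1 :
    (∀ (n : ℕ) {{_ : NonZero n}} → 3 ≤ n →
       ∀ (D : Fin n → Bool) (s k λ′ : ℕ) →
       s * s ≡ 8 * n ∸ 7 → 2 * k + s ≡ 2 * n ∸ 1 → λ′ + s ≡ n + 1 →
       IsDifferenceSet D n k λ′ →
       IsStrictlyDezaDihedrantWLRank4 (ΓD D))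
    × (∀ (m : ℕ) → 2 ≤ m → ¬ (4 ∣ m) → IsStrictlyDezaDihedrantWLRank4 (KK 4 m))
theorem1p1 = ΓD-isStrictlyDezaDihedrantWLRank4 , KK4-isStrictlyDezaDihedrantWLRank4
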